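{- Let $m \geq 3$ and $l_1\le\cdots\le l_m$ be natural numbers, $H = B(l_1,\ldots,l_m)$ and $G = H^2$. Then $G$ is equitably $(m+1)$-choosable.
   Context: $B(l_1,\ldots,l_m)$ denotes the graph with vertex set $\{u\}\cup\{v_{i,j}: i\in[m], j\in[l_i]\}$ where for each $i$ the vertices $u, v_{i,1},\ldots,v_{i,l_i}$ form a path in this order (a subdivision of $K_{1,m}$). $H^2$ is the square of $H$ (two vertices adjacent iff at distance at most 2 in $H$). A $k$-assignment $L$ assigns to each vertex a list of exactly $k$ colors; an equitable $L$-coloring of $G$ is a proper coloring $f$ with $f(v)\in L(v)$ using each color at most $\lceil |V(G)|/k\rceil$ times; $G$ is equitably $k$-choosable if it has an equitable $L$-coloring for every $k$-assignment $L$. -}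

module Defs where

open import Data.Nat using (ℕ; zero; suc; _+_; _∸_; _≤_; NonZero)
open import Data.Nat.DivMod using (_/_)
open import Data.Fin using (Fin; toℕ)
open import Data.List using (List; _∷_; map; concatMap; allFin; length; filter; sum)
open import Data.List.Membership.Propositional using (_∈_)
open import Data.List.Relation.Unary.Unique.Propositional using (Unique)
open import Data.Product using (Σ; ∃; _×_)
open import Data.Sum using (_⊎_)
open import Relation.Binary.PropositionalEquality using (_≡_; _≢_)
open import Relation.Nullary using (¬_)
open import Data.Nat using (_≟_)

⌈_/_⌉ : (n k : ℕ) → .{{NonZero k}} → ℕ
⌈ n / k ⌉ = (n + k ∸ 1) / k

-- Generic finite graphs: a vertex type, an explicit list enumerating all
-- vertices (each exactly once), and an adjacency relation.

Square : {V : Set} → (V → V → Set) → V → V → Set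
Square {V} adj x y = x ≢ y × (adj x y ⊎ Σ V (λ z → adj x z × adj z y))

IsAssignment : {V : Set} → ℕ → (V → List ℕ) → Set
IsAssignment {V} k L = (v : V) → length (L v) ≡ k × Unique (L v)

colorCount : {V : Set} → List V → (V → ℕ) → ℕ → ℕ
colorCount vs f c = length (filter (λ v → f v ≟ c) vs)

IsEquitableLColoring : {V : Set} → (vs : List V) → (adj : V → V → Set) →
                       (k : ℕ) → .{{NonZero k}} → (V → List ℕ) → (V → ℕ) → Set
IsEquitableLColoring {V} vs adj k L f =
  ((x y : V) → adj x y → f x ≢ f y) ×
  ((v : V) → f v ∈ L v) ×
  ((c : ℕ) → colorCount vs f c ≤ ⌈ length vs / k ⌉)

EquitablyChoosable : {V : Set} → (vs : List V) → (adj : V → V → Set) →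
                     (k : ℕ) → .{{NonZero k}} → Set
EquitablyChoosable {V} vs adj k =
  (L : V → List ℕ) → IsAssignment k L →
  Σ (V → ℕ) (λ f → IsEquitableLColoring vs adj k L f)

-- The spider B(l_1,…,l_m): root u, and leg i is the path
-- u, v_{i,1}, …, v_{i,l_i}.  Here  leg i j  (j : Fin (l i)) is v_{i,j+1}.

data BVertex (m : ℕ) (l : Fin m → ℕ) : Set where
  root : BVertex m l
  leg  : (i : Fin m) → Fin (l i) → BVertex m l

bVertices : (m : ℕ) (l : Fin m → ℕ) → List (BVertex m l)
bVertices m l = root ∷ concatMap (λ i → map (leg i) (allFin (l i))) (allFin m)

data BAdj {m : ℕ} {l : Fin m → ℕ} : BVertex m l → BVertex m l → Set where
  root-leg : (i : Fin m) (j : Fin (l i)) → toℕ j ≡ 0 → BAdj root (leg i j)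
  leg-root : (i : Fin m) (j : Fin (l i)) → toℕ j ≡ 0 → BAdj (leg i j) root
  leg-next : (i : Fin m) (j j' : Fin (l i)) → toℕ j' ≡ suc (toℕ j) →
             BAdj (leg i j) (leg i j')
  leg-prev : (i : Fin m) (j j' : Fin (l i)) → toℕ j ≡ suc (toℕ j') →
             BAdj (leg i j) (leg i j')

BSqAdj : {m : ℕ} {l : Fin m → ℕ} → BVertex m l → BVertex m l → Set
BSqAdj = Square BAdj

module Submission where

-- The proof is a greedy list colouring.  We order the vertices and partition them into
-- at most ⌈|V|/(m+1)⌉ chunks so that every vertex has at most m earlier vertices that
-- are adjacent to it in the square or lie in its chunk (its back set).  Colouring
-- greedily then never runs out of colours, and no colour repeats inside a chunk, so
-- every colour class is small enough (module GreedyEquitable).  For m ≥ 4 (module ManyLegs) the chunks are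
-- the windows of m+1 consecutive vertices, ordered inside by a tier.  For m = 3 (module
-- ThreeLegs) the legs are cut into blocks of 4 from the outside; the remaining spider,
-- with legs of length at most 4, is handled by a table of schemes checked by evaluation.

open import Defs
open import Function using (_∘_; _$_)
open import Data.Unit using (⊤; tt)
open import Data.Empty using (⊥)
open import Data.Product using (∃-syntax; _×_; _,_; proj₁; proj₂; swap; map₁)
open import Data.Sum using (_⊎_; inj₁; inj₂; [_,_]) renaming (map to map-⊎)
open import Data.Nat using (ℕ; zero; suc; _+_; _*_; _∸_; _≤_; _<_; z≤n; s≤s; z<s; NonZero; _/_; _%_; _≟_; _<?_; _≤?_)
open import Data.Nat.Properties
open import Data.Nat.DivMod
open import Data.Nat.Divisibility using (n∣m*n)
open import Data.Nat.Tactic.RingSolver using (solve-∀)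
open import Data.Fin using (Fin; toℕ; zero; suc; fromℕ<)
open import Data.Fin.Properties using (toℕ<n; toℕ-injective; toℕ-fromℕ<)
open import Data.List using (List; []; _∷_; map; filter; length; upTo; applyUpTo; _++_; concat; concatMap; allFin; tabulate)
open import Data.List.Properties
  using (length-map; length-upTo; filter-notAll; map-cong; map-cong-local; map-∘; map-tabulate; tabulate-cong; map-concatMap; concatMap-cong)
open import Data.List.Membership.Propositional using (_∈_; _∉_)
open import Data.List.Membership.Propositional.Properties
  using (∈-filter⁺; ∈-filter⁻; ∈-map⁺; ∈-map⁻; ∈-upTo⁺; ∈-applyUpTo⁺; ∈-++⁺ˡ; ∈-++⁺ʳ)
open import Data.List.Membership.DecPropositional _≟_ using (_∈?_)
open import Data.List.Relation.Unary.Any as Any using (Any; here; there)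
open import Data.List.Relation.Unary.All as All using (All; []; _∷_)
open import Data.List.Relation.Unary.All.Properties using (¬All⇒Any¬)
open import Data.List.Relation.Unary.AllPairs using ([]; _∷_)
open import Data.List.Relation.Unary.Unique.Propositional using (Unique)
import Data.List.Relation.Unary.Unique.Propositional.Properties as Unique
open import Relation.Nullary using (¬_; Dec; yes; no; ¬?; contradiction)
open import Relation.Nullary.Decidable using (_×-dec_; _⊎-dec_; _→-dec_; toWitness; decidable-stable)
open import Relation.Binary.Definitions using (tri<; tri≈; tri>)
open import Relation.Binary.PropositionalEquality
  using (_≡_; _≢_; refl; sym; trans; cong; cong₂; subst; subst₂; module ≡-Reasoning)

-- Counting with duplicate-free lists of natural numbers.

remove : ℕ → List ℕ → List ℕ
remove x = filter (λ y → ¬? (y ≟ x))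

remove-< : ∀ {x ys} → x ∈ ys → length (remove x ys) < length ys
remove-< {x} {ys} x∈ys =
  filter-notAll (λ y → ¬? (y ≟ x)) ys (Any.map (λ x≡y y≢x → y≢x (sym x≡y)) x∈ys)

unique-⊆-length : ∀ xs ys → Unique xs → All (_∈ ys) xs → length xs ≤ length ys
unique-⊆-length []       ys _              _                 = z≤n
unique-⊆-length (x ∷ xs) ys (x∉xs ∷ xs-uq) (x∈ys ∷ xs⊆ys) =
  ≤-trans (s≤s (unique-⊆-length xs (remove x ys) xs-uq (survive x∉xs xs⊆ys))) (remove-< x∈ys)
  where
  survive : ∀ {zs} → All (x ≢_) zs → All (_∈ ys) zs → All (_∈ remove x ys) zs
  survive []            []           = []
  survive (x≢z ∷ x≢zs) (z∈ys ∷ zs⊆ys) =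
    ∈-filter⁺ (λ y → ¬? (y ≟ x)) z∈ys (x≢z ∘ sym) ∷ survive x≢zs zs⊆ys

injection-length : ∀ {A : Set} (xs : List A) (g : A → ℕ) ys → Unique xs →
                   (∀ {w} → w ∈ xs → g w ∈ ys) →
                   (∀ {w w'} → w ∈ xs → w' ∈ xs → w ≢ w' → g w ≢ g w') → length xs ≤ length ys
injection-length xs g ys xs-uq g∈ys g-inj = begin
  length xs           ≡⟨ length-map g xs ⟨
  length (map g xs)   ≤⟨ unique-⊆-length (map g xs) ys (images-unique xs-uq (All.tabulate (λ p → p))) (All.tabulate image∈) ⟩
  length ys           ∎
  where
  open ≤-Reasoning
  image∈ : ∀ {x} → x ∈ map g xs → x ∈ ys
  image∈ x∈ with ∈-map⁻ g x∈
  ... | w , w∈ , refl = g∈ys w∈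
  images-unique : ∀ {zs} → Unique zs → All (_∈ xs) zs → Unique (map g zs)
  images-unique []              []                = []
  images-unique (z∉zs ∷ zs-uq) (z∈xs ∷ zs⊆xs) =
    distinct z∉zs zs⊆xs ∷ images-unique zs-uq zs⊆xs
    where
    distinct : ∀ {ys} → All (_ ≢_) ys → All (_∈ xs) ys → All (g _ ≢_) (map g ys)
    distinct []           []            = []
    distinct (z≢y ∷ z≢ys) (y∈xs ∷ ys⊆xs) = g-inj z∈xs y∈xs z≢y ∷ distinct z≢ys ys⊆xs

injection-bound : ∀ {A : Set} (xs : List A) (g : A → ℕ) b → Unique xs →
                  (∀ {w} → w ∈ xs → g w < b) →
                  (∀ {w w'} → w ∈ xs → w' ∈ xs → w ≢ w' → g w ≢ g w') → length xs ≤ b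
injection-bound xs g b xs-uq g<b g-inj =
  subst (length xs ≤_) (length-upTo b) (injection-length xs g (upTo b) xs-uq (∈-upTo⁺ ∘ g<b) g-inj)

injection-bound⁺ : ∀ {A : Set} (xs : List A) (x : A) (g : A → ℕ) b → Unique xs → g x < b →
                   (∀ {w} → w ∈ xs → g w < b) → (∀ {w} → w ∈ xs → g w ≢ g x) →
                   (∀ {w w'} → w ∈ xs → w' ∈ xs → w ≢ w' → g w ≢ g w') → suc (length xs) ≤ b
injection-bound⁺ xs x g b xs-uq gx<b g<b gw≢gx g-inj =
  injection-bound (x ∷ xs) g b (x∉xs ∷ xs-uq) lt inj
  where
  x∉xs : All (x ≢_) xs
  x∉xs = All.tabulate (λ w∈ x≡w → gw≢gx w∈ (cong g (sym x≡w)))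
  lt : ∀ {w} → w ∈ x ∷ xs → g w < b
  lt (here refl) = gx<b
  lt (there w∈)  = g<b w∈
  inj : ∀ {w w'} → w ∈ x ∷ xs → w' ∈ x ∷ xs → w ≢ w' → g w ≢ g w'
  inj (here refl) (here refl) w≢w' = contradiction refl w≢w'
  inj (here refl) (there w'∈) _    = gw≢gx w'∈ ∘ sym
  inj (there w∈)  (here refl) _    = gw≢gx w∈
  inj (there w∈)  (there w'∈) w≢w' = g-inj w∈ w'∈ w≢w'

-- The first entry of xs that does not occur in ys (0 if there is none).
freshColour : List ℕ → List ℕ → ℕ
freshColour []       ys = 0
freshColour (x ∷ xs) ys with x ∈? ys
... | yes _ = freshColour xs ys
... | no  _ = x

freshColour-spec : ∀ xs ys → Any (_∉ ys) xs → freshColour xs ys ∈ xs × freshColour xs ys ∉ ys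
freshColour-spec (x ∷ xs) ys fresh with x ∈? ys
... | no x∉ys = here refl , x∉ys
freshColour-spec (x ∷ xs) ys (here x∉ys) | yes x∈ys = contradiction x∈ys x∉ys
freshColour-spec (x ∷ xs) ys (there fresh) | yes _ with freshColour-spec xs ys fresh
... | c∈xs , c∉ys = there c∈xs , c∉ys

longer-has-fresh : ∀ xs ys → Unique xs → length ys < length xs → Any (_∉ ys) xs
longer-has-fresh xs ys xs-uq ys<xs =
  ¬All⇒Any¬ (_∈? ys) xs (λ xs⊆ys → <⇒≱ ys<xs (unique-⊆-length xs ys xs-uq xs⊆ys))

-- Greedy list colouring along a vertex order refined by a partition into chunks.
--
-- The back set of v consists of the
-- earlier vertices that are near v or share its chunk.  Colouring greedily in rank
-- order, v receives the first colour of its list not used on its back set.  If every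
-- back set has at most m elements and the lists have m+1 colours, this never gets
-- stuck; the colouring is proper, and a colour never repeats inside a chunk, so
-- each colour class has at most as many elements as there are chunks.
module GreedyEquitable
  {V : Set} (vs : List V) (vs-unique : Unique vs) (vs-complete : ∀ v → v ∈ vs)
  (Near : V → V → Set) (near? : ∀ v w → Dec (Near v w))
  (rank : V → ℕ) (rank-injective : ∀ {v w} → rank v ≡ rank w → v ≡ w)
  (chunk : V → ℕ)
  where

  Earlier : V → V → Set
  Earlier v w = rank w < rank v × (Near v w ⊎ chunk w ≡ chunk v)

  earlier? : ∀ v w → Dec (Earlier v w)
  earlier? v w = (rank w <? rank v) ×-dec (near? v w ⊎-dec (chunk w ≟ chunk v))

  back : V → List V
  back v = filter (earlier? v) vs

  back-sound : ∀ {v w} → w ∈ back v → Earlier v w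
  back-sound {v} = proj₂ ∘ ∈-filter⁻ (earlier? v) {xs = vs}

  back-complete : ∀ {v w} → Earlier v w → w ∈ back v
  back-complete {v} {w} = ∈-filter⁺ (earlier? v) (vs-complete w)

  back-unique : ∀ v → Unique (back v)
  back-unique v = Unique.filter⁺ (earlier? v) vs-unique

  module Greedy (L : V → List ℕ) where

    -- the greedy colour of v computed with fuel n; every n > rank v gives the same value
    greedy : ℕ → V → ℕ
    greedy zero    v = 0
    greedy (suc n) v = freshColour (L v) (map (greedy n) (back v))

    greedy-stable : ∀ a b v → rank v < a → rank v < b → greedy a v ≡ greedy b v
    greedy-stable (suc a) (suc b) v (s≤s rv≤a) (s≤s rv≤b) =
      cong (freshColour (L v)) (map-cong-local (All.tabulate λ {w} w∈ →
        let rw<rv = proj₁ (back-sound w∈) in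
        greedy-stable a b w (<-≤-trans rw<rv rv≤a) (<-≤-trans rw<rv rv≤b)))

    colouring : V → ℕ
    colouring v = greedy (suc (rank v)) v

    colouring-eq : ∀ v → colouring v ≡ freshColour (L v) (map colouring (back v))
    colouring-eq v = cong (freshColour (L v)) (map-cong-local (All.tabulate λ {w} w∈ →
      greedy-stable (rank v) (suc (rank w)) w (proj₁ (back-sound w∈)) (n<1+n (rank w))))

  equitably-choosable : ∀ m B → (∀ v → length (back v) ≤ m) → (∀ v → chunk v < B) →
    B ≤ ⌈ length vs / suc m ⌉ →
    (adj : V → V → Set) → (∀ {x y} → adj x y → x ≢ y) → (∀ {x y} → adj x y → adj y x) →
    (∀ {x y} → adj x y → Near x y) → EquitablyChoosable vs adj (suc m)
  equitably-choosable m B back≤m chunk<B B≤ adj adj-irrefl adj-sym adj-near L L-ok =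
    colouring , proper , proj₁ ∘ valid , class-bound
    where
    open Greedy L

    valid : ∀ v → colouring v ∈ L v × colouring v ∉ map colouring (back v)
    valid v = subst (λ c → c ∈ L v × c ∉ map colouring (back v)) (sym (colouring-eq v))
      (freshColour-spec (L v) _ (longer-has-fresh (L v) _ (proj₂ (L-ok v)) used<available))
      where
      used<available : length (map colouring (back v)) < length (L v)
      used<available = begin-strict
        length (map colouring (back v)) ≡⟨ length-map colouring (back v) ⟩
        length (back v)                 ≤⟨ back≤m v ⟩
        m                               <⟨ n<1+n m ⟩
        suc m                           ≡⟨ proj₁ (L-ok v) ⟨
        length (L v)                    ∎
        where open ≤-Reasoning

    separated : ∀ {v w} → Earlier v w → colouring v ≢ colouring w
    separated {v} e cv≡cw =
      proj₂ (valid v) (subst (_∈ map colouring (back v)) (sym cv≡cw) (∈-map⁺ colouring (back-complete e)))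

    proper : ∀ x y → adj x y → colouring x ≢ colouring y
    proper x y a with <-cmp (rank x) (rank y)
    ... | tri< x<y _ _ = separated (x<y , inj₁ (adj-near (adj-sym a))) ∘ sym
    ... | tri≈ _ x≡y _ = contradiction (rank-injective x≡y) (adj-irrefl a)
    ... | tri> _ _ y<x = separated (y<x , inj₁ (adj-near a))

    one-per-chunk : ∀ {v w} → v ≢ w → colouring v ≡ colouring w → chunk v ≢ chunk w
    one-per-chunk {v} {w} v≢w same cv≡cw with <-cmp (rank v) (rank w)
    ... | tri< v<w _ _ = separated (v<w , inj₂ cv≡cw) (sym same)
    ... | tri≈ _ r≡ _  = v≢w (rank-injective r≡)
    ... | tri> _ _ w<v = separated (w<v , inj₂ (sym cv≡cw)) same

    -- a colour class meets every chunk at most once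
    class-bound : ∀ c → colorCount vs colouring c ≤ ⌈ length vs / suc m ⌉
    class-bound c = ≤-trans
      (injection-bound class chunk B (Unique.filter⁺ (λ v → colouring v ≟ c) vs-unique)
        (λ {w} _ → chunk<B w) (λ p q v≢w → one-per-chunk v≢w (trans (coloured-c p) (sym (coloured-c q)))))
      B≤
      where
      class : List V
      class = filter (λ v → colouring v ≟ c) vs
      coloured-c : ∀ {v} → v ∈ class → colouring v ≡ c
      coloured-c = proj₂ ∘ ∈-filter⁻ (λ v → colouring v ≟ c) {xs = vs}

-- Prefix sums of a family of leg lengths: leg i occupies the positions
-- prefix l i + 1, …, prefix l i + l i when the legs are laid out one after another.

total : ∀ {m} → (Fin m → ℕ) → ℕ
total {zero}  l = 0
total {suc m} l = l zero + total (l ∘ suc)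

prefix : ∀ {m} → (Fin m → ℕ) → Fin m → ℕ
prefix l zero    = 0
prefix l (suc i) = l zero + prefix (l ∘ suc) i

prefix-end≤total : ∀ {m} (l : Fin m → ℕ) i → prefix l i + l i ≤ total l
prefix-end≤total l zero    = m≤m+n (l zero) _
prefix-end≤total l (suc i) = begin
  l zero + prefix (l ∘ suc) i + l (suc i)   ≡⟨ +-assoc (l zero) _ _ ⟩
  l zero + (prefix (l ∘ suc) i + l (suc i)) ≤⟨ +-monoʳ-≤ (l zero) (prefix-end≤total (l ∘ suc) i) ⟩
  l zero + total (l ∘ suc)                  ∎
  where open ≤-Reasoning

prefix-end≤prefix : ∀ {m} (l : Fin m → ℕ) i i' → toℕ i < toℕ i' → prefix l i + l i ≤ prefix l i'
prefix-end≤prefix l zero    (suc i') _         = m≤m+n (l zero) _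
prefix-end≤prefix l (suc i) (suc i') (s≤s i<i') = begin
  l zero + prefix (l ∘ suc) i + l (suc i)   ≡⟨ +-assoc (l zero) _ _ ⟩
  l zero + (prefix (l ∘ suc) i + l (suc i)) ≤⟨ +-monoʳ-≤ (l zero) (prefix-end≤prefix (l ∘ suc) i i' i<i') ⟩
  l zero + prefix (l ∘ suc) i'              ∎
  where open ≤-Reasoning

prefix-disjoint : ∀ {m} (l : Fin m → ℕ) i a x → prefix l i ≤ x → x < prefix l i + l i →
                  prefix l a ≤ x → x < prefix l a + l a → i ≡ a
prefix-disjoint l i a x i≤x x<i a≤x x<a with <-cmp (toℕ i) (toℕ a)
... | tri< i<a _ _ = contradiction (<-≤-trans x<i (prefix-end≤prefix l i a i<a)) (≤⇒≯ a≤x)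
... | tri≈ _ i≡a _ = toℕ-injective i≡a
... | tri> _ _ a<i = contradiction (<-≤-trans x<a (prefix-end≤prefix l a i a<i)) (≤⇒≯ i≤x)

prefix-last : ∀ {m} (l : Fin m → ℕ) c → suc (toℕ c) ≡ m → prefix l c + l c ≡ total l
prefix-last {suc zero}    l zero    _    = sym (+-identityʳ (l zero))
prefix-last {suc (suc m)} l (suc c) last =
  trans (+-assoc (l zero) _ _) (cong (l zero +_) (prefix-last (l ∘ suc) c (suc-injective last)))

prefix-bound : ∀ {m} (l : Fin m → ℕ) c b → (∀ i → toℕ i < toℕ c → l i ≤ b) → prefix l c ≤ toℕ c * b
prefix-bound l zero    b short = z≤n
prefix-bound l (suc c) b short =
  +-mono-≤ (short zero z<s) (prefix-bound (l ∘ suc) c b (λ i i<c → short (suc i) (s≤s i<c)))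

tabulate-toℕ : ∀ {A : Set} n (g : ℕ → A) → tabulate (g ∘ toℕ {n}) ≡ applyUpTo g n
tabulate-toℕ zero    g = refl
tabulate-toℕ (suc n) g = cong (g 0 ∷_) (tabulate-toℕ n (g ∘ suc))

applyUpTo-+ : ∀ {A : Set} (g : ℕ → A) x y → applyUpTo g (x + y) ≡ applyUpTo g x ++ applyUpTo (g ∘ (x +_)) y
applyUpTo-+ g zero    y = refl
applyUpTo-+ g (suc x) y = cong (g 0 ∷_) (applyUpTo-+ (g ∘ suc) x y)

concatMap-allFin-suc : ∀ {A : Set} {m} (f : Fin (suc m) → List A) →
                       concatMap f (allFin (suc m)) ≡ f zero ++ concatMap (f ∘ suc) (allFin m)
concatMap-allFin-suc {m = m} f = cong (λ xs → f zero ++ concat xs)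
  (trans (map-tabulate suc f) (sym (map-tabulate (λ i → i) (f ∘ suc))))

legs-positions : ∀ {A : Set} {m} (l : Fin m → ℕ) (g : ℕ → A) →
  concatMap (λ i → tabulate (λ (j : Fin (l i)) → g (prefix l i + toℕ j))) (allFin m) ≡ applyUpTo g (total l)
legs-positions {m = zero}  l g = refl
legs-positions {A} {suc m} l g = begin
  concatMap legPos (allFin (suc m))
    ≡⟨ concatMap-allFin-suc legPos ⟩
  legPos zero ++ concatMap (legPos ∘ suc) (allFin m)
    ≡⟨ cong₂ _++_ (tabulate-toℕ (l zero) g)
         (cong concat (map-cong (λ i → tabulate-cong (λ j → cong g (+-assoc (l zero) _ _))) (allFin m))) ⟩
  applyUpTo g (l zero) ++ concatMap (λ i → tabulate (λ (j : Fin (l (suc i))) → g (l zero + (prefix (l ∘ suc) i + toℕ j)))) (allFin m)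
    ≡⟨ cong (applyUpTo g (l zero) ++_) (legs-positions (l ∘ suc) (g ∘ (l zero +_))) ⟩
  applyUpTo g (l zero) ++ applyUpTo (g ∘ (l zero +_)) (total (l ∘ suc))
    ≡⟨ applyUpTo-+ g (l zero) _ ⟨
  applyUpTo g (total l) ∎
  where
  open ≡-Reasoning
  legPos : Fin (suc m) → List A
  legPos i = tabulate (λ (j : Fin (l i)) → g (prefix l i + toℕ j))

-- The spider B(l), its vertices numbered consecutively: the root is 0 and the legs
-- follow one after another, each listed from the root outwards.
module Spider (m : ℕ) (l : Fin m → ℕ) where

  V : Set
  V = BVertex m l

  vs : List V
  vs = bVertices m l

  N : ℕ
  N = suc (total l)

  pos : V → ℕ
  pos root      = 0
  pos (leg i j) = suc (prefix l i + toℕ j)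

  positions : map pos vs ≡ upTo N
  positions = cong (0 ∷_) $ begin
    map pos (concatMap (λ i → map (leg i) (allFin (l i))) (allFin m))
      ≡⟨ map-concatMap pos _ (allFin m) ⟩
    concatMap (λ i → map pos (map (leg i) (allFin (l i)))) (allFin m)
      ≡⟨ concatMap-cong (λ i → trans (sym (map-∘ (allFin (l i)))) (map-tabulate (λ j → j) (pos ∘ leg i))) (allFin m) ⟩
    concatMap (λ i → tabulate (λ (j : Fin (l i)) → suc (prefix l i + toℕ j))) (allFin m)
      ≡⟨ legs-positions l suc ⟩
    applyUpTo suc (total l) ∎
    where open ≡-Reasoning

  vs-unique : Unique vs
  vs-unique = Unique.map⁻ (subst Unique (sym positions) (Unique.upTo⁺ N))

  length-vs : length vs ≡ N
  length-vs = trans (sym (length-map pos vs)) (trans (cong length positions) (length-upTo N))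

  pos-surjective : ∀ q → q < N → ∃[ v ] pos v ≡ q
  pos-surjective q q<N with ∈-map⁻ pos (subst (q ∈_) (sym positions) (∈-upTo⁺ q<N))
  ... | v , _ , q≡pos = v , sym q≡pos

  pos<N : ∀ v → pos v < N
  pos<N root      = s≤s z≤n
  pos<N (leg i j) = s≤s (≤-trans (+-monoʳ-< (prefix l i) (toℕ<n j)) (prefix-end≤total l i))

  earlier-leg : ∀ i j i' j' → toℕ i < toℕ i' → pos (leg i j) < pos (leg i' j')
  earlier-leg i j i' j' i<i' =
    s≤s (≤-trans (+-monoʳ-< (prefix l i) (toℕ<n j)) (≤-trans (prefix-end≤prefix l i i' i<i') (m≤m+n _ _)))

  pos-injective : ∀ {v w} → pos v ≡ pos w → v ≡ w
  pos-injective {root}    {root}      _ = refl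
  pos-injective {leg i j} {leg i' j'} e with <-cmp (toℕ i) (toℕ i')
  ... | tri< i<i' _ _ = contradiction e (<⇒≢ (earlier-leg i j i' j' i<i'))
  ... | tri> _ _ i'<i = contradiction (sym e) (<⇒≢ (earlier-leg i' j' i j i'<i))
  ... | tri≈ _ i≡i' _ with toℕ-injective i≡i'
  ... | refl = cong (leg i) (toℕ-injective (+-cancelˡ-≡ (prefix l i) _ _ (suc-injective e)))

  vs-complete : ∀ v → v ∈ vs
  vs-complete v with ∈-map⁻ pos (subst (pos v ∈_) (sym positions) (∈-upTo⁺ (pos<N v)))
  ... | w , w∈vs , e = subst (_∈ vs) (sym (pos-injective e)) w∈vs

  -- Distance at most two in B(l), written out explicitly: it is decidable.
  Close : V → V → Set
  Close root       root        = ⊥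
  Close root       (leg i j)   = toℕ j ≤ 1
  Close (leg i j)  root        = toℕ j ≤ 1
  Close (leg i j)  (leg i' j') =
    (toℕ i ≡ toℕ i' × toℕ j ≤ toℕ j' + 2 × toℕ j' ≤ toℕ j + 2) ⊎ (toℕ j ≡ 0 × toℕ j' ≡ 0)

  close? : ∀ v w → Dec (Close v w)
  close? root       root        = no (λ ())
  close? root       (leg i j)   = toℕ j ≤? 1
  close? (leg i j)  root        = toℕ j ≤? 1
  close? (leg i j)  (leg i' j') =
    (toℕ i ≟ toℕ i' ×-dec toℕ j ≤? toℕ j' + 2 ×-dec toℕ j' ≤? toℕ j + 2) ⊎-dec (toℕ j ≟ 0 ×-dec toℕ j' ≟ 0)

  within-two : ∀ {a b} d → d ≤ 2 → b ≡ d + a → a ≤ b + 2 × b ≤ a + 2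
  within-two {a} d d≤2 refl = ≤-trans (m≤n+m a d) (m≤m+n _ 2) , subst (_≤ a + 2) (+-comm a d) (+-monoʳ-≤ a d≤2)

  along-leg : ∀ i (j j' : Fin (l i)) d → d ≤ 2 → toℕ j' ≡ d + toℕ j → Close (leg i j) (leg i j')
  along-leg i j j' d d≤2 e = inj₁ (refl , within-two d d≤2 e)

  back-along-leg : ∀ i (j j' : Fin (l i)) d → d ≤ 2 → toℕ j ≡ d + toℕ j' → Close (leg i j) (leg i j')
  back-along-leg i j j' d d≤2 e = inj₁ (refl , swap (within-two d d≤2 e))

  edge⇒close : ∀ {x y} → BAdj x y → Close x y
  edge⇒close (root-leg i j j≡0)   = ≤-trans (≤-reflexive j≡0) z≤n
  edge⇒close (leg-root i j j≡0)   = ≤-trans (≤-reflexive j≡0) z≤n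
  edge⇒close (leg-next i j j' e)  = along-leg i j j' 1 (s≤s z≤n) e
  edge⇒close (leg-prev i j j' e)  = back-along-leg i j j' 1 (s≤s z≤n) e

  path₂⇒close : ∀ {x y z} → BAdj x z → BAdj z y → x ≢ y → Close x y
  path₂⇒close (root-leg i j e)     (leg-root .i .j _)     x≢y = contradiction refl x≢y
  path₂⇒close (root-leg i j e)     (leg-next .i .j j' e') _   = ≤-reflexive (trans e' (cong suc e))
  path₂⇒close (root-leg i j e)     (leg-prev .i .j j' e') _   = contradiction (trans (sym e) e') 0≢1+n
  path₂⇒close (leg-root i j e)     (root-leg i' j' e')    _   = inj₂ (e , e')
  path₂⇒close (leg-next i j j' e)  (leg-root .i .j' e')   _   = contradiction (trans (sym e') e) 0≢1+n
  path₂⇒close (leg-prev i j j' e)  (leg-root .i .j' e')   _   = ≤-reflexive (trans e (cong suc e'))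
  path₂⇒close (leg-next i j j' e)  (leg-next .i .j' j'' e') _ = along-leg i j j'' 2 ≤-refl (trans e' (cong suc e))
  path₂⇒close (leg-next i j j' e)  (leg-prev .i .j' j'' e') _ = along-leg i j j'' 0 z≤n (suc-injective (trans (sym e') e))
  path₂⇒close (leg-prev i j j' e)  (leg-next .i .j' j'' e') _ = along-leg i j j'' 0 z≤n (trans e' (sym e))
  path₂⇒close (leg-prev i j j' e)  (leg-prev .i .j' j'' e') _ = back-along-leg i j j'' 2 ≤-refl (trans e (cong suc e'))

  square⇒close : ∀ {x y} → BSqAdj x y → Close x y
  square⇒close (_   , inj₁ xy)            = edge⇒close xy
  square⇒close (x≢y , inj₂ (_ , xz , zy)) = path₂⇒close xz zy x≢y

  edge-sym : ∀ {x y : V} → BAdj x y → BAdj y x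
  edge-sym (root-leg i j e)    = leg-root i j e
  edge-sym (leg-root i j e)    = root-leg i j e
  edge-sym (leg-next i j j' e) = leg-prev i j' j e
  edge-sym (leg-prev i j j' e) = leg-next i j' j e

  square-sym : ∀ {x y : V} → BSqAdj x y → BSqAdj y x
  square-sym (x≢y , inj₁ xy)            = x≢y ∘ sym , inj₁ (edge-sym xy)
  square-sym (x≢y , inj₂ (z , xz , zy)) = x≢y ∘ sym , inj₂ (z , edge-sym zy , edge-sym xz)

-- Lexicographic encoding: a pair (a , o) with o < k is encoded as a * k + o.

divmod-unique : ∀ k .{{_ : NonZero k}} a o → o < k → (a * k + o) / k ≡ a × (a * k + o) % k ≡ o
divmod-unique k a o o<k = quotient , remainder
  where
  open ≡-Reasoning
  remainder : (a * k + o) % k ≡ o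
  remainder = begin
    (a * k + o) % k ≡⟨ cong (_% k) (+-comm (a * k) o) ⟩
    (o + a * k) % k ≡⟨ [m+kn]%n≡m%n o a k ⟩
    o % k           ≡⟨ m<n⇒m%n≡m o<k ⟩
    o               ∎
  no-carry : o % k + (a * k) % k < k
  no-carry = subst₂ (λ x y → x + y < k) (sym (m<n⇒m%n≡m o<k)) (sym (m*n%n≡0 a k)) (subst (_< k) (sym (+-identityʳ o)) o<k)
  quotient : (a * k + o) / k ≡ a
  quotient = begin
    (a * k + o) / k       ≡⟨ cong (_/ k) (+-comm (a * k) o) ⟩
    (o + a * k) / k       ≡⟨ +-distrib-/ o (a * k) no-carry ⟩
    o / k + (a * k) / k   ≡⟨ cong₂ _+_ (m<n⇒m/n≡0 o<k) (m*n/n≡m a k) ⟩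
    a                     ∎

lex-≡ : ∀ k .{{_ : NonZero k}} a a' o o' → o < k → o' < k → a * k + o ≡ a' * k + o' → a ≡ a' × o ≡ o'
lex-≡ k a a' o o' o<k o'<k e =
  trans (sym (proj₁ (divmod-unique k a o o<k))) (trans (cong (_/ k) e) (proj₁ (divmod-unique k a' o' o'<k))) ,
  trans (sym (proj₂ (divmod-unique k a o o<k))) (trans (cong (_% k) e) (proj₂ (divmod-unique k a' o' o'<k)))

lex-step : ∀ k a a' o o' → a < a' → o < k → a * k + o < a' * k + o'
lex-step k a a' o o' a<a' o<k = begin-strict
  a * k + o    <⟨ +-monoʳ-< (a * k) o<k ⟩
  a * k + k    ≡⟨ +-comm (a * k) k ⟩
  suc a * k    ≤⟨ *-monoˡ-≤ k a<a' ⟩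
  a' * k       ≤⟨ m≤m+n (a' * k) o' ⟩
  a' * k + o'  ∎
  where open ≤-Reasoning

lex-< : ∀ k a a' o o' → o < k → o' < k → a * k + o < a' * k + o' → a < a' ⊎ (a ≡ a' × o < o')
lex-< k a a' o o' o<k o'<k lt with <-cmp a a'
... | tri< a<a' _ _ = inj₁ a<a'
... | tri≈ _ refl _ = inj₂ (refl , +-cancelˡ-< (a * k) o o' lt)
... | tri> _ _ a'<a = contradiction lt (<-asym (lex-step k a' a o' o a'<a o'<k))

last-index : ∀ c m → c < m → m + m ≤ suc (suc (c * 2 + 1)) → suc c ≡ m
last-index c m c<m 2m≤ = ≤-antisym c<m (≮⇒≥ not-before-last)
  where
  double : ∀ c → suc (suc c) + suc (suc c) ≡ suc (suc (suc (c * 2 + 1)))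
  double = solve-∀
  not-before-last : ¬ suc c < m
  not-before-last c+1<m = 1+n≰n (begin
    suc (suc (suc (c * 2 + 1)))  ≡⟨ double c ⟨
    suc (suc c) + suc (suc c)    ≤⟨ +-mono-≤ c+1<m c+1<m ⟩
    m + m                        ≤⟨ 2m≤ ⟩
    suc (suc (c * 2 + 1))        ∎)
    where open ≤-Reasoning

half-step : ∀ x y → x + 2 ≤ y → x / 2 < y / 2
half-step x y x+2≤y = begin-strict
  x / 2                    <⟨ n<1+n (x / 2) ⟩
  suc (x / 2)              ≡⟨ cong (λ z → suc (z / 2)) (m+n∸n≡m x 2) ⟨
  suc ((x + 2 ∸ 2) / 2)    ≡⟨ m/n≡1+[m∸n]/n (m≤n+m 2 x) ⟨
  (x + 2) / 2              ≤⟨ /-monoˡ-≤ 2 x+2≤y ⟩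
  y / 2                    ∎
  where open ≤-Reasoning

half-room : ∀ m → 4 ≤ m → 3 + (m ∸ 1) / 2 ≤ m
half-room (suc (suc (suc zero))) (s≤s (s≤s (s≤s ())))
half-room (suc (suc (suc (suc n)))) _ = begin
  3 + (3 + n) / 2          ≡⟨ cong (3 +_) (m/n≡1+[m∸n]/n {3 + n} {2} (s≤s (s≤s z≤n))) ⟩
  4 + (1 + n) / 2          ≤⟨ +-monoʳ-≤ 4 (≤-pred (m/n<m (1 + n) 2 (s≤s (s≤s z≤n)))) ⟩
  4 + n                    ∎
  where open ≤-Reasoning

same-quotient : ∀ x y d → x / suc d ≡ y / suc d → y ≤ x + d
same-quotient x y d e = begin
  y                              ≡⟨ m≡m%n+[m/n]*n y (suc d) ⟩
  y % suc d + y / suc d * suc d  ≤⟨ +-monoˡ-≤ _ (≤-pred (m%n<n y (suc d))) ⟩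
  d + y / suc d * suc d          ≡⟨ cong (λ z → d + z * suc d) e ⟨
  d + x / suc d * suc d          ≤⟨ +-monoʳ-≤ d (m/n*n≤m x (suc d)) ⟩
  d + x                          ≡⟨ +-comm d x ⟩
  x + d                          ∎
  where open ≤-Reasoning

window<ceiling : ∀ p n k .{{_ : NonZero k}} → p < n → p / k < ⌈ n / k ⌉
window<ceiling p (suc n) k p<n = begin-strict
  p / k                ≡⟨ cong (_/ k) (m+n∸n≡m p k) ⟨
  (p + k ∸ k) / k      <⟨ n<1+n _ ⟩
  suc ((p + k ∸ k) / k) ≡⟨ m/n≡1+[m∸n]/n (m≤n+m k p) ⟨
  (p + k) / k          ≤⟨ /-monoˡ-≤ k (+-monoˡ-≤ k (≤-pred p<n)) ⟩
  (n + k) / k          ≡⟨⟩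
  (suc n + k ∸ 1) / k  ∎
  where open ≤-Reasoning

-- B(l)² with m ≥ 4 legs of non-decreasing lengths.
--
-- The chunks are the windows of k = m+1 consecutive positions.  Inside a window the
-- vertices are ordered by tier and then by position: tier 0 are the root and the heads
-- (first vertices of legs), tier 1 the other vertex at offset 0 of the window, tier 2
-- the other vertices at offset 1 and the second vertices of legs, tier 3 the rest.
module ManyLegs (m : ℕ) (4≤m : 4 ≤ m) (l : Fin m → ℕ)
  (ascending : ∀ i j → toℕ i ≤ toℕ j → l i ≤ l j) where

  open Spider m l

  k : ℕ
  k = suc m

  window : V → ℕ
  window v = pos v / k

  offset : V → ℕ
  offset v = pos v % k

  offset<k : ∀ v → offset v < k
  offset<k v = m%n<n (pos v) k

  pos-split : ∀ v → pos v ≡ window v * k + offset v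
  pos-split v = trans (m≡m%n+[m/n]*n (pos v) k) (+-comm (offset v) _)

  window-start≤pos : ∀ v → window v * k ≤ pos v
  window-start≤pos v = subst (window v * k ≤_) (sym (pos-split v)) (m≤m+n _ (offset v))

  tierOf : ℕ → ℕ → ℕ
  tierOf zero          _             = 0
  tierOf (suc _)       zero          = 1
  tierOf (suc _)       (suc zero)    = 2
  tierOf (suc zero)    (suc (suc _)) = 2
  tierOf (suc (suc _)) (suc (suc _)) = 3

  tierOf<4 : ∀ j o → tierOf j o < 4
  tierOf<4 zero          _             = s≤s z≤n
  tierOf<4 (suc _)       zero          = s≤s (s≤s z≤n)
  tierOf<4 (suc _)       (suc zero)    = s≤s (s≤s (s≤s z≤n))
  tierOf<4 (suc zero)    (suc (suc _)) = s≤s (s≤s (s≤s z≤n))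
  tierOf<4 (suc (suc _)) (suc (suc _)) = ≤-refl

  tierOf≡0 : ∀ j o → tierOf j o ≡ 0 → j ≡ 0
  tierOf≡0 zero          _             _  = refl
  tierOf≡0 (suc _)       zero          ()
  tierOf≡0 (suc _)       (suc zero)    ()
  tierOf≡0 (suc zero)    (suc (suc _)) ()
  tierOf≡0 (suc (suc _)) (suc (suc _)) ()

  tier : V → ℕ
  tier root      = 0
  tier (leg i j) = tierOf (toℕ j) (offset (leg i j))

  tier<4 : ∀ v → tier v < 4
  tier<4 root      = s≤s z≤n
  tier<4 (leg i j) = tierOf<4 _ _

  rank : V → ℕ
  rank v = (window v * 4 + tier v) * k + offset v

  same-slot : ∀ {v w} → window v ≡ window w → offset v ≡ offset w → v ≡ w
  same-slot {v} {w} e e' =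
    pos-injective (trans (pos-split v) (trans (cong₂ (λ a o → a * k + o) e e') (sym (pos-split w))))

  rank-injective : ∀ {v w} → rank v ≡ rank w → v ≡ w
  rank-injective {v} {w} e =
    let major , offsets = lex-≡ k _ _ _ _ (offset<k v) (offset<k w) e
    in  same-slot (proj₁ (lex-≡ 4 _ _ _ _ (tier<4 v) (tier<4 w) major)) offsets

  data Precedes (v w : V) : Set where
    earlier-window : window w < window v → Precedes v w
    lower-tier     : window w ≡ window v → tier w < tier v → Precedes v w
    smaller-offset : window w ≡ window v → tier w ≡ tier v → offset w < offset v → Precedes v w

  precedes : ∀ {v w} → rank w < rank v → Precedes v w
  precedes {v} {w} w<v with lex-< k _ _ _ _ (offset<k w) (offset<k v) w<v
  ... | inj₂ (major , o<o') = let same , tier≡ = lex-≡ 4 _ _ _ _ (tier<4 w) (tier<4 v) major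
                              in  smaller-offset same tier≡ o<o'
  ... | inj₁ major<         with lex-< 4 _ _ _ _ (tier<4 w) (tier<4 v) major<
  ...   | inj₁ window<         = earlier-window window<
  ...   | inj₂ (same , tier<)  = lower-tier same tier<

  earlier-window⇒before : ∀ v w → window w < window v → pos w < pos v
  earlier-window⇒before v w w<v = ≰⇒> (λ v≤w → <⇒≱ w<v (/-monoˡ-≤ k v≤w))

  smaller-offset⇒before : ∀ v w → window w ≡ window v → offset w < offset v → pos w < pos v
  smaller-offset⇒before v w e o<o' = subst₂ _<_ (sym (pos-split w)) (sym (pos-split v))
    (subst (λ a → a * k + offset w < window v * k + offset v) (sym e) (+-monoʳ-< (window v * k) o<o'))

  near-behind : ∀ v w δ → pos w + δ ≡ pos v → δ ≤ offset v → window w ≡ window v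
  near-behind v w δ e δ≤o = trans (cong (_/ k) (sym w-split))
    (proj₁ (divmod-unique k (window v) (offset v ∸ δ) (≤-<-trans (m∸n≤m (offset v) δ) (offset<k v))))
    where
    open ≡-Reasoning
    w-split : window v * k + (offset v ∸ δ) ≡ pos w
    w-split = begin
      window v * k + (offset v ∸ δ)  ≡⟨ +-∸-assoc (window v * k) δ≤o ⟨
      window v * k + offset v ∸ δ    ≡⟨ cong (_∸ δ) (pos-split v) ⟨
      pos v ∸ δ                      ≡⟨ cong (_∸ δ) e ⟨
      pos w + δ ∸ δ                  ≡⟨ m+n∸n≡m (pos w) δ ⟩
      pos w                          ∎

  leg-order : ∀ i j i' j' → pos (leg i' j') < pos (leg i j) → toℕ i' ≤ toℕ i
  leg-order i j i' j' lt = ≮⇒≥ (λ i<i' → <-asym lt (earlier-leg i j i' j' i<i'))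

  index-order : ∀ i j (j' : Fin (l i)) → pos (leg i j') < pos (leg i j) → toℕ j' < toℕ j
  index-order i j j' lt = +-cancelˡ-< (prefix l i) _ _ (≤-pred lt)

  open GreedyEquitable vs vs-unique vs-complete Close close? rank rank-injective window

  rank<  : ∀ {v w} → w ∈ back v → rank w < rank v
  rank< {v} w∈ = proj₁ (back-sound {v} w∈)

  precedes-in-back : ∀ {v w} → w ∈ back v → Precedes v w
  precedes-in-back {v} w∈ = precedes (rank< {v} w∈)

  not-self : ∀ {v w} → w ∈ back v → w ≢ v
  not-self {v} w∈ refl = <-irrefl refl (rank< {v} w∈)

  close-if-earlier-window : ∀ {v w} → w ∈ back v → window w < window v → Close v w
  close-if-earlier-window {v} w∈ w< with proj₂ (back-sound {v} w∈)
  ... | inj₁ close = close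
  ... | inj₂ same  = contradiction same (<⇒≢ w<)

  window-offset : ∀ v w₀ o → pos v ≡ w₀ * k + o → o < k → window v ≡ w₀ × offset v ≡ o
  window-offset v w₀ o e o<k =
    trans (cong (_/ k) e) (proj₁ (divmod-unique k w₀ o o<k)) , trans (cong (_% k) e) (proj₂ (divmod-unique k w₀ o o<k))

  tierOf≡3 : ∀ a b → 2 ≤ a → 2 ≤ b → tierOf a b ≡ 3
  tierOf≡3 (suc (suc _)) (suc (suc _)) _              _              = refl
  tierOf≡3 (suc _)       (suc zero)    _              (s≤s ())
  tierOf≡3 (suc zero)    (suc (suc _)) (s≤s ())       _

  -- the offset m - 2 ≥ 2, where the search for a tier-3 vertex starts
  m₂ : ℕ
  m₂ = m ∸ 2

  2+m₂ : 2 + m₂ ≡ m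
  2+m₂ = m+[n∸m]≡n (≤-trans (s≤s (s≤s z≤n)) 4≤m)

  2≤m₂ : 2 ≤ m₂
  2≤m₂ = +-cancelˡ-≤ 2 2 m₂ (subst (4 ≤_) (sym 2+m₂) 4≤m)

  m₂<k : m₂ < k
  m₂<k = s≤s (m∸n≤m m 2)

  k≤w₀k : ∀ w₀ → 1 ≤ w₀ → k ≤ w₀ * k
  k≤w₀k w₀ 1≤w₀ = subst (_≤ w₀ * k) (*-identityˡ k) (*-monoˡ-≤ k 1≤w₀)

  short-leg-ends-window : ∀ w₀ c (j' : Fin (l c)) → 1 ≤ w₀ → l c ≤ 2 → toℕ j' ≤ 1 →
                          pos (leg c j') ≡ w₀ * k + m₂ → N ≤ w₀ * k + m
  short-leg-ends-window w₀ c j' 1≤w₀ lc≤2 j'≤1 e = begin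
    suc (total l)                              ≡⟨ cong suc (prefix-last l c last) ⟨
    suc (prefix l c + l c)                     ≤⟨ s≤s (+-monoʳ-≤ (prefix l c) lc≤2) ⟩
    suc (prefix l c + 2)                       ≡⟨ cong (λ x → suc (prefix l c + x)) (m+[n∸m]≡n j'≤2) ⟨
    suc (prefix l c + (toℕ j' + (2 ∸ toℕ j'))) ≡⟨ cong suc (+-assoc (prefix l c) (toℕ j') _) ⟨
    pos (leg c j') + (2 ∸ toℕ j')              ≡⟨ cong (_+ (2 ∸ toℕ j')) e ⟩
    w₀ * k + m₂ + (2 ∸ toℕ j')                 ≤⟨ +-monoʳ-≤ (w₀ * k + m₂) (m∸n≤m 2 (toℕ j')) ⟩
    w₀ * k + m₂ + 2                            ≡⟨ +-assoc (w₀ * k) m₂ 2 ⟩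
    w₀ * k + (m₂ + 2)                          ≡⟨ cong (w₀ * k +_) (trans (+-comm m₂ 2) 2+m₂) ⟩
    w₀ * k + m                                 ∎
    where
    open ≤-Reasoning
    j'≤2 : toℕ j' ≤ 2
    j'≤2 = ≤-trans j'≤1 (n≤1+n 1)
    -- the legs before c have length at most 2, so leg c starts by position 2c
    early : pos (leg c j') ≤ suc (toℕ c * 2 + 1)
    early = s≤s (+-mono-≤ (prefix-bound l c 2 (λ i i<c → ≤-trans (ascending i c (<⇒≤ i<c)) lc≤2)) j'≤1)
    last : suc (toℕ c) ≡ m
    last = last-index (toℕ c) m (toℕ<n c) (begin
      m + m                 ≡⟨ cong (m +_) 2+m₂ ⟨
      m + (2 + m₂)          ≡⟨ +-suc m (suc m₂) ⟩
      suc (m + suc m₂)      ≡⟨ cong suc (+-suc m m₂) ⟩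
      suc (k + m₂)          ≤⟨ s≤s (+-monoˡ-≤ m₂ (k≤w₀k w₀ 1≤w₀)) ⟩
      suc (w₀ * k + m₂)     ≡⟨ cong suc e ⟨
      suc (pos (leg c j'))  ≤⟨ s≤s early ⟩
      suc (suc (toℕ c * 2 + 1)) ∎)

  -- A full window other than the first contains a vertex of tier 3: look at offset m-2.
  tier3-in-full-window : ∀ w₀ → 1 ≤ w₀ → w₀ * k + m < N → ∃[ z ] window z ≡ w₀ × tier z ≡ 3
  tier3-in-full-window w₀ 1≤w₀ full with pos-surjective (w₀ * k + m₂) (≤-<-trans (+-monoʳ-≤ (w₀ * k) (m∸n≤m m 2)) full)
  ... | root , e = contradiction (≤-trans (k≤w₀k w₀ 1≤w₀) (≤-trans (m≤m+n (w₀ * k) m₂) (≤-reflexive (sym e)))) (λ ())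
  ... | leg c j' , e with window-offset (leg c j') w₀ m₂ e m₂<k | 2 ≤? toℕ j'
  ...   | w≡ , o≡ | yes 2≤j' = leg c j' , w≡ , tierOf≡3 _ _ 2≤j' (subst (2 ≤_) (sym o≡) 2≤m₂)
  ...   | _       | no  j'<2 with 3 ≤? l c
  ...     | no lc<3 =
    contradiction full (≤⇒≯ (short-leg-ends-window w₀ c j' 1≤w₀ (≤-pred (≰⇒> lc<3)) (≤-pred (≰⇒> j'<2)) e))
  ...     | yes 3≤lc = third , proj₁ third-slot , tierOf≡3 _ _ (≤-reflexive (sym third≡2))
                                    (subst (2 ≤_) (sym (proj₂ third-slot)) (≤-trans 2≤m₂ (m≤m+n m₂ δ)))
    where
    two : Fin (l c)
    two = fromℕ< 3≤lc
    third : V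
    third = leg c two
    third≡2 : toℕ two ≡ 2
    third≡2 = toℕ-fromℕ< 3≤lc
    δ : ℕ
    δ = 2 ∸ toℕ j'
    j'≤2 : toℕ j' ≤ 2
    j'≤2 = ≤-trans (≤-pred (≰⇒> j'<2)) (n≤1+n 1)
    third-pos : pos third ≡ w₀ * k + (m₂ + δ)
    third-pos = begin
      suc (prefix l c + toℕ two)          ≡⟨ cong (λ x → suc (prefix l c + x)) (trans third≡2 (sym (m+[n∸m]≡n j'≤2))) ⟩
      suc (prefix l c + (toℕ j' + δ))     ≡⟨ cong suc (+-assoc (prefix l c) (toℕ j') δ) ⟨
      pos (leg c j') + δ                  ≡⟨ cong (_+ δ) e ⟩
      w₀ * k + m₂ + δ                     ≡⟨ +-assoc (w₀ * k) m₂ δ ⟩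
      w₀ * k + (m₂ + δ)                   ∎
      where open ≡-Reasoning
    third-slot : window third ≡ w₀ × offset third ≡ m₂ + δ
    third-slot = window-offset third w₀ (m₂ + δ) third-pos
      (s≤s (≤-trans (+-monoʳ-≤ m₂ (m∸n≤m 2 (toℕ j'))) (≤-reflexive (trans (+-comm m₂ 2) 2+m₂))))

  -- the root comes first, so its back set is empty
  root-bound : length (back root) ≤ m
  root-bound = ≤-trans
    (injection-bound (back root) (λ _ → 0) 0 (back-unique root)
      (λ {w} w∈ → contradiction (rank< {root} w∈) n≮0) (λ {w} w∈ → contradiction (rank< {root} w∈) n≮0))
    z≤n

  -- The back set of a head consists of the root and heads of earlier legs.
  module HeadBound (i : Fin m) (j : Fin (l i)) (j≡0 : toℕ j ≡ 0) where

    tier-head : tier (leg i j) ≡ 0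
    tier-head = cong (λ a → tierOf a (offset (leg i j))) j≡0

    earlier-head : ∀ i' (j' : Fin (l i')) → toℕ j' ≡ 0 → pos (leg i' j') < pos (leg i j) → toℕ i' < toℕ i
    earlier-head i' j' j'≡0 lt with <-cmp (toℕ i') (toℕ i)
    ... | tri< i'<i _ _ = i'<i
    ... | tri> _ _ i<i' = contradiction (leg-order i j i' j' lt) (<⇒≱ i<i')
    ... | tri≈ _ i'≡i _ with toℕ-injective i'≡i
    ... | refl = contradiction (subst₂ _<_ j'≡0 j≡0 (index-order i j j' lt)) n≮0

    back-heads : ∀ {i' j'} → leg i' j' ∈ back (leg i j) → toℕ j' ≡ 0 × toℕ i' < toℕ i
    back-heads {i'} {j'} w∈ with precedes-in-back {leg i j} w∈
    ... | lower-tier _ t< = contradiction (subst (_ <_) tier-head t<) n≮0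
    ... | smaller-offset same t≡ o< =
      let j'≡0 = tierOf≡0 _ _ (trans t≡ tier-head)
      in  j'≡0 , earlier-head i' j' j'≡0 (smaller-offset⇒before (leg i j) (leg i' j') same o<)
    ... | earlier-window w< with close-if-earlier-window {leg i j} w∈ w<
    ...   | inj₂ (_ , j'≡0) = j'≡0 , earlier-head i' j' j'≡0 (earlier-window⇒before (leg i j) (leg i' j') w<)
    ...   | inj₁ (i≡i' , _) with toℕ-injective i≡i'
    ...     | refl = contradiction (subst (toℕ j' <_) j≡0 (index-order i j j' (earlier-window⇒before (leg i j) (leg i j') w<))) n≮0

    slot : V → ℕ
    slot root       = 0
    slot (leg i' _) = suc (toℕ i')

    bound : length (back (leg i j)) ≤ m
    bound = ≤-trans (injection-bound (back (leg i j)) slot (suc (toℕ i)) (back-unique (leg i j)) below injective) (toℕ<n i)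
      where
      below : ∀ {w} → w ∈ back (leg i j) → slot w < suc (toℕ i)
      below {root}    _  = s≤s z≤n
      below {leg _ _} w∈ = s≤s (proj₂ (back-heads w∈))
      injective : ∀ {w w'} → w ∈ back (leg i j) → w' ∈ back (leg i j) → w ≢ w' → slot w ≢ slot w'
      injective {root}    {root}      _ _ w≢w' _ = w≢w' refl
      injective {leg a b} {leg a' b'} p q w≢w' e with toℕ-injective (suc-injective e)
      ... | refl = w≢w' (cong (leg a) (toℕ-injective (trans (proj₁ (back-heads p)) (sym (proj₁ (back-heads q))))))

  module Tail (i : Fin m) (j : Fin (l i)) (j₀ : ℕ) (j≡ : toℕ j ≡ suc j₀) where

    v : V
    v = leg i j

    -- what an element of the back set from an earlier window can be
    data Behind (w : V) : Set where
      root-behind : w ≡ root → toℕ j ≡ 1 → Behind w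
      one-behind  : pos w + 1 ≡ pos v → Behind w
      two-behind  : pos w + 2 ≡ pos v → 2 ≤ toℕ j → Behind w

    pos-along : ∀ (j' : Fin (l i)) d → toℕ j ≡ toℕ j' + d → pos (leg i j') + d ≡ pos v
    pos-along j' d e = cong suc (trans (+-assoc (prefix l i) (toℕ j') d) (cong (prefix l i +_) (sym e)))

    step-behind : ∀ (j' : Fin (l i)) → toℕ j' < toℕ j → toℕ j ≤ toℕ j' + 2 → Behind (leg i j')
    step-behind j' j'<j j≤j'+2 with toℕ j ≟ suc (toℕ j')
    ... | yes e   = one-behind (pos-along j' 1 (trans e (+-comm 1 (toℕ j'))))
    ... | no  j≢  = two-behind (pos-along j' 2 (≤-antisym j≤j'+2 two≤)) (≤-trans (m≤n+m 2 (toℕ j')) two≤)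
      where
      two≤ : toℕ j' + 2 ≤ toℕ j
      two≤ = subst (_≤ toℕ j) (+-comm 2 (toℕ j')) (≤∧≢⇒< j'<j (j≢ ∘ sym))

    behind : ∀ {w} → w ∈ back v → window w < window v → Behind w
    behind {root} w∈ w< =
      root-behind refl (≤-antisym (close-if-earlier-window {v} w∈ w<) (subst (1 ≤_) (sym j≡) (s≤s z≤n)))
    behind {leg i' j'} w∈ w< with close-if-earlier-window {v} w∈ w<
    ... | inj₂ (j≡0 , _)        = contradiction (trans (sym j≡0) j≡) 0≢1+n
    ... | inj₁ (i≡i' , j≤ , _) with toℕ-injective i≡i'
    ...   | refl = step-behind j' (index-order i j j' (earlier-window⇒before v (leg i j') w<)) j≤

    -- If the back set lies in the window of v, offsets inject it together with v into the window.
    bound-within-window : (∀ {w} → w ∈ back v → window w ≡ window v) → length (back v) ≤ m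
    bound-within-window same = ≤-pred
      (injection-bound⁺ (back v) v offset k (back-unique v) (offset<k v) (λ {w} _ → offset<k w)
        (λ w∈ e → not-self {v} w∈ (same-slot (same w∈) e))
        (λ w∈ w'∈ w≢w' e → w≢w' (same-slot (trans (same w∈) (sym (same w'∈))) e)))

    -- Tier 3 (j ≥ 2 and offset ≥ 2): nothing from an earlier window is close to v.
    tier3-bound : 2 ≤ toℕ j → 2 ≤ offset v → length (back v) ≤ m
    tier3-bound 2≤j 2≤o = bound-within-window same-window
      where
      same-window : ∀ {w} → w ∈ back v → window w ≡ window v
      same-window {w} w∈ with precedes-in-back {v} w∈
      ... | lower-tier same _       = same
      ... | smaller-offset same _ _ = same
      ... | earlier-window w< with behind w∈ w<
      ...   | root-behind _ j≡1 = contradiction (subst (2 ≤_) j≡1 2≤j) (<⇒≱ (s≤s (s≤s z≤n)))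
      ...   | one-behind e      = contradiction (near-behind v w 1 e (≤-trans (s≤s z≤n) 2≤o)) (<⇒≢ w<)
      ...   | two-behind e _    = contradiction (near-behind v w 2 e 2≤o) (<⇒≢ w<)

    outside-behind : ∀ {w} → w ∈ back v → window w ≢ window v → Behind w
    outside-behind {w} w∈ w≢ with precedes-in-back {v} w∈
    ... | earlier-window w<       = behind w∈ w<
    ... | lower-tier same _       = contradiction same w≢
    ... | smaller-offset same _ _ = contradiction same w≢

    -- Tier 2 at offset ≥ 1.  Apart from window-mates, the back set contains at most one
    -- vertex (from an earlier window); it is given a spare offset of the window of v.
    module Tier2 (tier2 : tier v ≡ 2) (1≤o : 1 ≤ offset v) where

      mate-not-tier3 : ∀ {w} → w ∈ back v → window w ≡ window v → tier w ≢ 3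
      mate-not-tier3 {w} w∈ same t≡3 with precedes-in-back {v} w∈
      ... | earlier-window w<      = <⇒≢ w< same
      ... | lower-tier _ t<        = ≤⇒≯ (n≤1+n 2) (subst₂ _<_ t≡3 tier2 t<)
      ... | smaller-offset _ t≡ _  = contradiction (trans (sym t≡3) (trans t≡ tier2)) (λ ())

      -- at most one element of the back set comes from an earlier window: since offset v ≥ 1,
      -- the vertex one position behind v is a window-mate
      outside-unique : ∀ {w w'} → w ∈ back v → w' ∈ back v → window w ≢ window v → window w' ≢ window v → w ≡ w'
      outside-unique {w} {w'} p q w≢ w'≢ with outside-behind p w≢ | outside-behind q w'≢
      ... | one-behind e         | _                    = contradiction (near-behind v w 1 e 1≤o) w≢
      ... | _                    | one-behind e         = contradiction (near-behind v w' 1 e 1≤o) w'≢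
      ... | root-behind refl _   | root-behind refl _   = refl
      ... | root-behind _ j≡1    | two-behind _ 2≤j     = contradiction (subst (2 ≤_) j≡1 2≤j) (<⇒≱ (s≤s (s≤s z≤n)))
      ... | two-behind _ 2≤j     | root-behind _ j≡1    = contradiction (subst (2 ≤_) j≡1 2≤j) (<⇒≱ (s≤s (s≤s z≤n)))
      ... | two-behind e _       | two-behind e' _      = pos-injective (+-cancelʳ-≡ 2 _ _ (trans e (sym e')))

      module WithSpare (spare : ℕ) (spare<k : spare < k) (spare≢o : spare ≢ offset v)
                       (unused : ∀ {w} → w ∈ back v → window w ≡ window v → offset w ≢ spare) where

        choose : ∀ {w} → Dec (window w ≡ window v) → ℕ
        choose {w} (yes _) = offset w
        choose     (no  _) = spare

        slot : V → ℕ
        slot w = choose {w} (window w ≟ window v)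

        slot-v : slot v ≡ offset v
        slot-v with window v ≟ window v
        ... | yes _   = refl
        ... | no  v≢v = contradiction refl v≢v

        slot<k : ∀ w → slot w < k
        slot<k w with window w ≟ window v
        ... | yes _ = offset<k w
        ... | no  _ = spare<k

        slot≢v : ∀ {w} → w ∈ back v → slot w ≢ slot v
        slot≢v {w} w∈ with window w ≟ window v
        ... | yes same = λ e → not-self {v} w∈ (same-slot same (trans e slot-v))
        ... | no  _    = λ e → spare≢o (trans e slot-v)

        slot-injective : ∀ {w w'} → w ∈ back v → w' ∈ back v → w ≢ w' → slot w ≢ slot w'
        slot-injective {w} {w'} p q w≢w' with window w ≟ window v | window w' ≟ window v
        ... | yes a | yes b = w≢w' ∘ same-slot (trans a (sym b))
        ... | yes a | no  _ = unused p a
        ... | no  _ | yes b = unused q b ∘ sym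
        ... | no  a | no  b = λ _ → w≢w' (outside-unique p q a b)

        bound : length (back v) ≤ m
        bound = ≤-pred (injection-bound⁺ (back v) v slot k (back-unique v) (slot<k v) (λ {w} _ → slot<k w) slot≢v slot-injective)

      -- in the first window there is no earlier window
      first-window-bound : window v ≡ 0 → length (back v) ≤ m
      first-window-bound first = bound-within-window same-window
        where
        same-window : ∀ {w} → w ∈ back v → window w ≡ window v
        same-window {w} w∈ with precedes-in-back {v} w∈
        ... | earlier-window w<       = contradiction (subst (window w <_) first w<) n≮0
        ... | lower-tier same _       = same
        ... | smaller-offset same _ _ = same

      -- in a full window the offset of a tier-3 vertex is spare
      full-window-bound : window v ≢ 0 → window v * k + m < N → length (back v) ≤ m
      full-window-bound not-first full with tier3-in-full-window (window v) (n≢0⇒n>0 not-first) full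
      ... | z , z-window , z-tier3 = WithSpare.bound (offset z) (offset<k z) spare≢o unused
        where
        spare≢o : offset z ≢ offset v
        spare≢o e = contradiction (trans (sym z-tier3) (trans (cong tier (same-slot {z} {v} z-window e)) tier2)) (λ ())
        unused : ∀ {w} → w ∈ back v → window w ≡ window v → offset w ≢ offset z
        unused {w} w∈ same e = mate-not-tier3 w∈ same (trans (cong tier (same-slot {w} {z} (trans same (sym z-window)) e)) z-tier3)

      -- in a window cut off by the end of the spider the offset just past the end is spare
      cut-window-bound : N ≤ window v * k + m → length (back v) ≤ m
      cut-window-bound ends = WithSpare.bound spare spare<k (λ e → <-irrefl (sym e) (below-spare v refl))
                                (λ {w} _ same e → <-irrefl e (below-spare w same))
        where
        spare : ℕ
        spare = N ∸ window v * k
        spare<k : spare < k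
        spare<k = s≤s (≤-trans (∸-monoˡ-≤ (window v * k) ends) (≤-reflexive (m+n∸m≡n (window v * k) m)))
        below-spare : ∀ w → window w ≡ window v → offset w < spare
        below-spare w same = +-cancelˡ-< (window v * k) _ _ (begin-strict
          window v * k + offset w    ≡⟨ cong (λ a → a * k + offset w) same ⟨
          window w * k + offset w    ≡⟨ pos-split w ⟨
          pos w                      <⟨ pos<N w ⟩
          N                          ≡⟨ m+[n∸m]≡n (≤-trans (window-start≤pos v) (<⇒≤ (pos<N v))) ⟨
          window v * k + spare       ∎)
          where open ≤-Reasoning

      bound : length (back v) ≤ m
      bound with window v ≟ 0 | window v * k + m <? N
      ... | yes first    | _           = first-window-bound first
      ... | no not-first | yes full    = full-window-bound not-first full
      ... | no _         | no not-full = cut-window-bound (≮⇒≥ not-full)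

    -- Tier 1: offset 0 and j ≥ 1.  The back set consists of at most two vertices just
    -- behind v (gaps 0 and 1) and of heads in the window of v.  Those heads lie on later
    -- legs, which have length at least 2, so their offsets are at least 2 apart and
    -- halving them gives distinct slots 2, 3, … below m.
    module Tier1 (o≡0 : offset v ≡ 0) where

      tier1 : tier v ≡ 1
      tier1 = cong₂ tierOf j≡ o≡0

      2≤li : 2 ≤ l i
      2≤li = ≤-trans (s≤s (s≤s z≤n)) (subst (λ x → suc x ≤ l i) j≡ (toℕ<n j))

      2≤pos-v : 2 ≤ pos v
      2≤pos-v = s≤s (≤-trans (subst (1 ≤_) (sym j≡) (s≤s z≤n)) (m≤n+m (toℕ j) (prefix l i)))

      mate-offset≥1 : ∀ {w} → w ∈ back v → window w ≡ window v → 1 ≤ offset w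
      mate-offset≥1 {w} w∈ same with offset w ≟ 0
      ... | yes o'≡0 = contradiction (same-slot same (trans o'≡0 (sym o≡0))) (not-self {v} w∈)
      ... | no  o'≢0 = n≢0⇒n>0 o'≢0

      mate-after : ∀ {w} → w ∈ back v → window w ≡ window v → pos v < pos w
      mate-after {w} w∈ same = smaller-offset⇒before w v (sym same) (subst (_≤ offset w) (cong suc (sym o≡0)) (mate-offset≥1 w∈ same))

      mate-is-head : ∀ {w} → w ∈ back v → window w ≡ window v → tier w ≡ 0
      mate-is-head {w} w∈ same with precedes-in-back {v} w∈
      ... | earlier-window w<    = contradiction same (<⇒≢ w<)
      ... | smaller-offset _ _ o< = contradiction (subst (offset w <_) o≡0 o<) n≮0
      ... | lower-tier _ t<      = n<1⇒n≡0 (subst (tier w <_) tier1 t<)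

      mate-not-root : root ∈ back v → window root ≢ window v
      mate-not-root r∈ same = <⇒≱ (mate-after r∈ same) z≤n

      mate-leg-after : ∀ a b → leg a b ∈ back v → window (leg a b) ≡ window v → toℕ i < toℕ a
      mate-leg-after a b w∈ same with <-cmp (toℕ i) (toℕ a)
      ... | tri< i<a _ _ = i<a
      ... | tri> _ _ a<i = contradiction (leg-order a b i j (mate-after w∈ same)) (<⇒≱ a<i)
      ... | tri≈ _ i≡a _ with toℕ-injective i≡a
      ... | refl = contradiction (index-order i b j (mate-after w∈ same))
                     (subst (λ x → ¬ toℕ j < x) (sym (tierOf≡0 _ _ (mate-is-head w∈ same))) n≮0)

      spacing : ∀ a b a' b' → leg a b ∈ back v → leg a' b' ∈ back v →
                window (leg a b) ≡ window v → window (leg a' b') ≡ window v →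
                toℕ a < toℕ a' → offset (leg a b) + 2 ≤ offset (leg a' b')
      spacing a b a' b' p q same same' a<a' = +-cancelˡ-≤ (window v * k) _ _ (begin
        window v * k + (offset (leg a b) + 2)      ≡⟨ +-assoc (window v * k) _ 2 ⟨
        window v * k + offset (leg a b) + 2        ≡⟨ cong (λ x → x * k + offset (leg a b) + 2) same ⟨
        window (leg a b) * k + offset (leg a b) + 2 ≡⟨ cong (_+ 2) (pos-split (leg a b)) ⟨
        pos (leg a b) + 2                          ≤⟨ +-monoʳ-≤ (pos (leg a b)) 2≤la ⟩
        pos (leg a b) + l a                        ≡⟨ cong (λ x → suc (x + l a)) (trans (cong (prefix l a +_) b≡0) (+-identityʳ _)) ⟩
        suc (prefix l a + l a)                     ≤⟨ s≤s (prefix-end≤prefix l a a' a<a') ⟩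
        suc (prefix l a')                          ≡⟨ cong suc (trans (cong (prefix l a' +_) b'≡0) (+-identityʳ _)) ⟨
        pos (leg a' b')                            ≡⟨ pos-split (leg a' b') ⟩
        window (leg a' b') * k + offset (leg a' b') ≡⟨ cong (λ x → x * k + offset (leg a' b')) same' ⟩
        window v * k + offset (leg a' b')          ∎)
        where
        open ≤-Reasoning
        b≡0 : toℕ b ≡ 0
        b≡0 = tierOf≡0 _ _ (mate-is-head p same)
        b'≡0 : toℕ b' ≡ 0
        b'≡0 = tierOf≡0 _ _ (mate-is-head q same')
        2≤la : 2 ≤ l a
        2≤la = ≤-trans 2≤li (ascending i a (<⇒≤ (mate-leg-after a b p same)))

      shifted : ∀ {x y} → x + 2 ≤ y → 1 ≤ x → x ∸ 1 + 2 ≤ y ∸ 1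
      shifted {suc x} x+2≤y _ = ∸-monoˡ-≤ 1 x+2≤y

      mate-slots-differ : ∀ {w w'} → w ∈ back v → w' ∈ back v → window w ≡ window v → window w' ≡ window v →
                          w ≢ w' → (offset w ∸ 1) / 2 ≢ (offset w' ∸ 1) / 2
      mate-slots-differ {root}    p q same same' _ = contradiction same (mate-not-root p)
      mate-slots-differ {leg _ _} {root} p q same same' _ = contradiction same' (mate-not-root q)
      mate-slots-differ {leg a b} {leg a' b'} p q same same' w≢w' with <-cmp (toℕ a) (toℕ a')
      ... | tri< a<a' _ _ = <⇒≢ (half-step _ _ (shifted (spacing a b a' b' p q same same' a<a') (mate-offset≥1 p same)))
      ... | tri> _ _ a'<a = <⇒≢ (half-step _ _ (shifted (spacing a' b' a b q p same' same a'<a) (mate-offset≥1 q same'))) ∘ sym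
      ... | tri≈ _ a≡a' _ with toℕ-injective a≡a'
      ... | refl = contradiction (cong (leg a) (toℕ-injective (trans (tierOf≡0 _ _ (mate-is-head p same))
                                                          (sym (tierOf≡0 _ _ (mate-is-head q same')))))) w≢w'

      gap : V → ℕ
      gap root = 1
      gap w    = pos v ∸ suc (pos w)

      gap-leg : ∀ w d → pos w + suc d ≡ pos v → pos v ∸ suc (pos w) ≡ d
      gap-leg w d e = begin
        pos v ∸ suc (pos w)          ≡⟨ cong (_∸ suc (pos w)) e ⟨
        pos w + suc d ∸ suc (pos w)  ≡⟨ cong (_∸ suc (pos w)) (+-suc (pos w) d) ⟩
        pos w + d ∸ pos w            ≡⟨ m+n∸m≡n (pos w) d ⟩
        d                            ∎
        where open ≡-Reasoning

      gap-one : ∀ w → pos w + 1 ≡ pos v → gap w ≡ 0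
      gap-one root      e = contradiction (sym e) (>⇒≢ 2≤pos-v)
      gap-one (leg a b) e = gap-leg (leg a b) 0 e

      gap-two : ∀ w → pos w + 2 ≡ pos v → gap w ≡ 1
      gap-two root      _ = refl
      gap-two (leg a b) e = gap-leg (leg a b) 1 e

      gap≤1 : ∀ {w} → Behind w → gap w ≤ 1
      gap≤1 (root-behind refl _) = ≤-refl
      gap≤1 (one-behind e)       = ≤-trans (≤-reflexive (gap-one _ e)) z≤n
      gap≤1 (two-behind e _)     = ≤-reflexive (gap-two _ e)

      gap-injective : ∀ {w w'} → Behind w → Behind w' → gap w ≡ gap w' → w ≡ w'
      gap-injective (one-behind e)       (one-behind e')      _ = pos-injective (+-cancelʳ-≡ 1 _ _ (trans e (sym e')))
      gap-injective (two-behind e _)     (two-behind e' _)    _ = pos-injective (+-cancelʳ-≡ 2 _ _ (trans e (sym e')))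
      gap-injective (root-behind refl _) (root-behind refl _) _ = refl
      gap-injective (one-behind e)       (root-behind refl _) g = contradiction (trans (sym (gap-one _ e)) g) (λ ())
      gap-injective (root-behind refl _) (one-behind e)       g = contradiction (trans g (gap-one _ e)) (λ ())
      gap-injective (one-behind e)       (two-behind e' _)    g = contradiction (trans (sym (gap-one _ e)) (trans g (gap-two _ e'))) (λ ())
      gap-injective (two-behind e _)     (one-behind e')      g = contradiction (trans (sym (gap-one _ e')) (trans (sym g) (gap-two _ e))) (λ ())
      gap-injective (root-behind _ j≡1)  (two-behind _ 2≤j)   _ = contradiction (subst (2 ≤_) j≡1 2≤j) (<⇒≱ (s≤s (s≤s z≤n)))
      gap-injective (two-behind _ 2≤j)   (root-behind _ j≡1)  _ = contradiction (subst (2 ≤_) j≡1 2≤j) (<⇒≱ (s≤s (s≤s z≤n)))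

      choose : ∀ {w} → Dec (window w ≡ window v) → ℕ
      choose {w} (yes _) = 2 + (offset w ∸ 1) / 2
      choose {w} (no  _) = gap w

      slot : V → ℕ
      slot w = choose {w} (window w ≟ window v)

      -- the slots lie below m (here m ≥ 4 is used) and are injective on the back set
      slot<m : ∀ {w} → w ∈ back v → slot w < m
      slot<m {w} w∈ with window w ≟ window v
      ... | yes _  = ≤-trans (s≤s (+-monoʳ-≤ 2 (/-monoˡ-≤ 2 (∸-monoˡ-≤ 1 (≤-pred (offset<k w)))))) (half-room m 4≤m)
      ... | no  w≢ = ≤-trans (s≤s (gap≤1 (outside-behind w∈ w≢))) (≤-trans (s≤s (s≤s z≤n)) (≤-trans (n≤1+n 3) 4≤m))

      slot-injective : ∀ {w w'} → w ∈ back v → w' ∈ back v → w ≢ w' → slot w ≢ slot w'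
      slot-injective {w} {w'} p q w≢w' with window w ≟ window v | window w' ≟ window v
      ... | yes a | yes b = mate-slots-differ p q a b w≢w' ∘ +-cancelˡ-≡ 2 _ _
      ... | yes a | no  b = λ e → <⇒≱ (s≤s (gap≤1 (outside-behind q b))) (≤-trans (s≤s (s≤s z≤n)) (≤-reflexive e))
      ... | no  a | yes b = λ e → <⇒≱ (s≤s (gap≤1 (outside-behind p a))) (≤-trans (s≤s (s≤s z≤n)) (≤-reflexive (sym e)))
      ... | no  a | no  b = w≢w' ∘ gap-injective (outside-behind p a) (outside-behind q b)

      bound : length (back v) ≤ m
      bound = injection-bound (back v) slot m (back-unique v) slot<m slot-injective

  leg-bound : ∀ i j a → toℕ j ≡ a → ∀ o → offset (leg i j) ≡ o → length (back (leg i j)) ≤ m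
  leg-bound i j zero           j≡0 _             _   = HeadBound.bound i j j≡0
  leg-bound i j (suc j₀)       j≡  zero          o≡0 = Tail.Tier1.bound i j j₀ j≡ o≡0
  leg-bound i j (suc j₀)       j≡  (suc zero)    o≡1 =
    Tail.Tier2.bound i j j₀ j≡ (cong₂ tierOf j≡ o≡1) (≤-reflexive (sym o≡1))
  leg-bound i j (suc zero)     j≡  (suc (suc o)) o≡  =
    Tail.Tier2.bound i j 0 j≡ (cong₂ tierOf j≡ o≡) (≤-trans (s≤s z≤n) (≤-reflexive (sym o≡)))
  leg-bound i j (suc (suc j₁)) j≡  (suc (suc o)) o≡  =
    Tail.tier3-bound i j (suc j₁) j≡ (≤-trans (s≤s (s≤s z≤n)) (≤-reflexive (sym j≡)))
                                    (≤-trans (s≤s (s≤s z≤n)) (≤-reflexive (sym o≡)))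

  back-bound : ∀ v → length (back v) ≤ m
  back-bound root      = root-bound
  back-bound (leg i j) = leg-bound i j (toℕ j) refl (offset (leg i j)) refl

  square-equitably-choosable : EquitablyChoosable vs BSqAdj (suc m)
  square-equitably-choosable =
    equitably-choosable m ⌈ N / k ⌉ back-bound (λ v → window<ceiling (pos v) N k (pos<N v))
      (≤-reflexive (cong (λ n → ⌈ n / k ⌉) (sym length-vs))) BSqAdj proj₁ square-sym square⇒close

-- Spiders with three legs of lengths at most 4, checked by computation.
--
-- The vertices of such a spider are encoded by codes: 0 is the root and 1 + 4 i + j
-- is vertex j of leg i.  A scheme is a list of chunks, each listing its codes in the
-- order of colouring; the chunks are coloured one after another.

coreCodes : ℕ → ℕ → ℕ → List ℕ
coreCodes a b c = 0 ∷ applyUpTo (1 +_) a ++ applyUpTo (5 +_) b ++ applyUpTo (9 +_) c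

-- index of x in a list (its length if x does not occur)
indexIn : List ℕ → ℕ → ℕ
indexIn []       x = 0
indexIn (y ∷ ys) x with y ≟ x
... | yes _ = 0
... | no  _ = suc (indexIn ys x)

locate : List (List ℕ) → ℕ → ℕ × ℕ
locate []          x = 0 , 0
locate (ch ∷ chs) x with x ∈? ch
... | yes _ = 0 , indexIn ch x
... | no  _ = map₁ suc (locate chs x)

chunkOf : List (List ℕ) → ℕ → ℕ
chunkOf t x = proj₁ (locate t x)

placeOf : List (List ℕ) → ℕ → ℕ
placeOf t x = proj₂ (locate t x)

codeRank : List (List ℕ) → ℕ → ℕ
codeRank t x = chunkOf t x * 4 + placeOf t x

CodeClose : ℕ → ℕ → Set
CodeClose zero    zero    = ⊥
CodeClose zero    (suc y) = y % 4 ≤ 1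
CodeClose (suc x) zero    = x % 4 ≤ 1
CodeClose (suc x) (suc y) = (x / 4 ≡ y / 4 × x % 4 ≤ y % 4 + 2 × y % 4 ≤ x % 4 + 2) ⊎ (x % 4 ≡ 0 × y % 4 ≡ 0)

codeClose? : ∀ x y → Dec (CodeClose x y)
codeClose? zero    zero    = no (λ ())
codeClose? zero    (suc y) = y % 4 ≤? 1
codeClose? (suc x) zero    = x % 4 ≤? 1
codeClose? (suc x) (suc y) =
  (x / 4 ≟ y / 4 ×-dec x % 4 ≤? y % 4 + 2 ×-dec y % 4 ≤? x % 4 + 2) ⊎-dec (x % 4 ≟ 0 ×-dec y % 4 ≟ 0)

CodeBack : List (List ℕ) → ℕ → ℕ → Set
CodeBack t x y = codeRank t y < codeRank t x × (CodeClose x y ⊎ chunkOf t y ≡ chunkOf t x)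

codeBack? : ∀ t x y → Dec (CodeBack t x y)
codeBack? t x y = (codeRank t y <? codeRank t x) ×-dec (codeClose? x y ⊎-dec (chunkOf t y ≟ chunkOf t x))

ValidScheme : List (List ℕ) → ℕ → ℕ → ℕ → Set
ValidScheme t a b c =
  All (λ x → chunkOf t x < length t × placeOf t x < 4) codes ×
  All (λ x → All (λ y → codeRank t x ≡ codeRank t y → x ≡ y) codes) codes ×
  length t ≤ (1 + a + b + c + 3) / 4 ×
  All (λ x → length (filter (codeBack? t x) codes) ≤ 3) codes
  where
  codes : List ℕ
  codes = coreCodes a b c

validScheme? : ∀ t a b c → Dec (ValidScheme t a b c)
validScheme? t a b c =
  All.all? (λ x → chunkOf t x <? length t ×-dec placeOf t x <? 4) codes ×-dec
  All.all? (λ x → All.all? (λ y → codeRank t x ≟ codeRank t y →-dec x ≟ y) codes) codes ×-dec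
  length t ≤? (1 + a + b + c + 3) / 4 ×-dec
  All.all? (λ x → length (filter (codeBack? t x) codes) ≤? 3) codes
  where
  codes : List ℕ
  codes = coreCodes a b c

-- Schemes for all leg lengths 0-4, found by a computer search.
core-table : ℕ → ℕ → ℕ → List (List ℕ)
core-table 0 0 0 = (0 ∷ []) ∷ []
core-table 0 0 1 = (0 ∷ 9 ∷ []) ∷ []
core-table 0 0 2 = (0 ∷ 9 ∷ 10 ∷ []) ∷ []
core-table 0 0 3 = (0 ∷ 9 ∷ 10 ∷ 11 ∷ []) ∷ []
core-table 0 0 4 = (0 ∷ 9 ∷ 10 ∷ 11 ∷ []) ∷ (12 ∷ []) ∷ []
core-table 0 1 0 = (0 ∷ 5 ∷ []) ∷ []
core-table 0 1 1 = (0 ∷ 5 ∷ 9 ∷ []) ∷ []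
core-table 0 1 2 = (0 ∷ 5 ∷ 9 ∷ 10 ∷ []) ∷ []
core-table 0 1 3 = (0 ∷ 5 ∷ 9 ∷ 10 ∷ []) ∷ (11 ∷ []) ∷ []
core-table 0 1 4 = (0 ∷ 5 ∷ 9 ∷ 10 ∷ []) ∷ (11 ∷ 12 ∷ []) ∷ []
core-table 0 2 0 = (0 ∷ 5 ∷ 6 ∷ []) ∷ []
core-table 0 2 1 = (0 ∷ 5 ∷ 6 ∷ 9 ∷ []) ∷ []
core-table 0 2 2 = (0 ∷ 5 ∷ 6 ∷ 9 ∷ []) ∷ (10 ∷ []) ∷ []
core-table 0 2 3 = (0 ∷ 5 ∷ 6 ∷ 9 ∷ []) ∷ (10 ∷ 11 ∷ []) ∷ []
core-table 0 2 4 = (0 ∷ 5 ∷ 6 ∷ 9 ∷ []) ∷ (10 ∷ 11 ∷ 12 ∷ []) ∷ []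
core-table 0 3 0 = (0 ∷ 5 ∷ 6 ∷ 7 ∷ []) ∷ []
core-table 0 3 1 = (0 ∷ 5 ∷ 6 ∷ 7 ∷ []) ∷ (9 ∷ []) ∷ []
core-table 0 3 2 = (0 ∷ 5 ∷ 6 ∷ 7 ∷ []) ∷ (9 ∷ 10 ∷ []) ∷ []
core-table 0 3 3 = (0 ∷ 5 ∷ 6 ∷ 7 ∷ []) ∷ (9 ∷ 10 ∷ 11 ∷ []) ∷ []
core-table 0 3 4 = (0 ∷ 5 ∷ 6 ∷ 7 ∷ []) ∷ (9 ∷ 10 ∷ 11 ∷ 12 ∷ []) ∷ []
core-table 0 4 0 = (0 ∷ 5 ∷ 6 ∷ 7 ∷ []) ∷ (8 ∷ []) ∷ []
core-table 0 4 1 = (0 ∷ 5 ∷ 6 ∷ 7 ∷ []) ∷ (8 ∷ 9 ∷ []) ∷ []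
core-table 0 4 2 = (0 ∷ 5 ∷ 6 ∷ 7 ∷ []) ∷ (8 ∷ 9 ∷ 10 ∷ []) ∷ []
core-table 0 4 3 = (0 ∷ 5 ∷ 6 ∷ 7 ∷ []) ∷ (8 ∷ 9 ∷ 10 ∷ 11 ∷ []) ∷ []
core-table 0 4 4 = (0 ∷ 5 ∷ 6 ∷ 7 ∷ []) ∷ (8 ∷ 9 ∷ 10 ∷ 11 ∷ []) ∷ (12 ∷ []) ∷ []
core-table 1 0 0 = (0 ∷ 1 ∷ []) ∷ []
core-table 1 0 1 = (0 ∷ 1 ∷ 9 ∷ []) ∷ []
core-table 1 0 2 = (0 ∷ 1 ∷ 9 ∷ 10 ∷ []) ∷ []
core-table 1 0 3 = (0 ∷ 1 ∷ 9 ∷ 10 ∷ []) ∷ (11 ∷ []) ∷ []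
core-table 1 0 4 = (0 ∷ 1 ∷ 9 ∷ 10 ∷ []) ∷ (11 ∷ 12 ∷ []) ∷ []
core-table 1 1 0 = (0 ∷ 1 ∷ 5 ∷ []) ∷ []
core-table 1 1 1 = (0 ∷ 1 ∷ 5 ∷ 9 ∷ []) ∷ []
core-table 1 1 2 = (0 ∷ 1 ∷ 5 ∷ 9 ∷ []) ∷ (10 ∷ []) ∷ []
core-table 1 1 3 = (0 ∷ 1 ∷ 5 ∷ 9 ∷ []) ∷ (10 ∷ 11 ∷ []) ∷ []
core-table 1 1 4 = (0 ∷ 1 ∷ 5 ∷ 9 ∷ []) ∷ (10 ∷ 11 ∷ 12 ∷ []) ∷ []
core-table 1 2 0 = (0 ∷ 1 ∷ 5 ∷ 6 ∷ []) ∷ []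
core-table 1 2 1 = (0 ∷ 1 ∷ 5 ∷ 6 ∷ []) ∷ (9 ∷ []) ∷ []
core-table 1 2 2 = (0 ∷ 1 ∷ 5 ∷ 6 ∷ []) ∷ (9 ∷ 10 ∷ []) ∷ []
core-table 1 2 3 = (0 ∷ 1 ∷ 5 ∷ 6 ∷ []) ∷ (9 ∷ 10 ∷ 11 ∷ []) ∷ []
core-table 1 2 4 = (0 ∷ 1 ∷ 5 ∷ 6 ∷ []) ∷ (9 ∷ 10 ∷ 11 ∷ 12 ∷ []) ∷ []
core-table 1 3 0 = (0 ∷ 1 ∷ 5 ∷ 6 ∷ []) ∷ (7 ∷ []) ∷ []
core-table 1 3 1 = (0 ∷ 1 ∷ 5 ∷ 6 ∷ []) ∷ (9 ∷ 7 ∷ []) ∷ []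
core-table 1 3 2 = (0 ∷ 1 ∷ 5 ∷ 6 ∷ []) ∷ (9 ∷ 7 ∷ 10 ∷ []) ∷ []
core-table 1 3 3 = (0 ∷ 1 ∷ 5 ∷ 6 ∷ []) ∷ (9 ∷ 7 ∷ 10 ∷ 11 ∷ []) ∷ []
core-table 1 3 4 = (0 ∷ 1 ∷ 5 ∷ 6 ∷ []) ∷ (9 ∷ 7 ∷ 10 ∷ 11 ∷ []) ∷ (12 ∷ []) ∷ []
core-table 1 4 0 = (0 ∷ 1 ∷ 5 ∷ 6 ∷ []) ∷ (7 ∷ 8 ∷ []) ∷ []
core-table 1 4 1 = (0 ∷ 1 ∷ 5 ∷ 6 ∷ []) ∷ (9 ∷ 7 ∷ 8 ∷ []) ∷ []
core-table 1 4 2 = (0 ∷ 1 ∷ 5 ∷ 9 ∷ []) ∷ (6 ∷ 10 ∷ 7 ∷ 8 ∷ []) ∷ []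
core-table 1 4 3 = (0 ∷ 1 ∷ 5 ∷ 9 ∷ []) ∷ (6 ∷ 10 ∷ 7 ∷ 8 ∷ []) ∷ (11 ∷ []) ∷ []
core-table 1 4 4 = (0 ∷ 1 ∷ 5 ∷ 9 ∷ []) ∷ (6 ∷ 10 ∷ 7 ∷ 8 ∷ []) ∷ (11 ∷ 12 ∷ []) ∷ []
core-table 2 0 0 = (0 ∷ 1 ∷ 2 ∷ []) ∷ []
core-table 2 0 1 = (0 ∷ 1 ∷ 2 ∷ 9 ∷ []) ∷ []
core-table 2 0 2 = (0 ∷ 1 ∷ 2 ∷ 9 ∷ []) ∷ (10 ∷ []) ∷ []
core-table 2 0 3 = (0 ∷ 1 ∷ 2 ∷ 9 ∷ []) ∷ (10 ∷ 11 ∷ []) ∷ []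
core-table 2 0 4 = (0 ∷ 1 ∷ 2 ∷ 9 ∷ []) ∷ (10 ∷ 11 ∷ 12 ∷ []) ∷ []
core-table 2 1 0 = (0 ∷ 1 ∷ 2 ∷ 5 ∷ []) ∷ []
core-table 2 1 1 = (0 ∷ 1 ∷ 2 ∷ 5 ∷ []) ∷ (9 ∷ []) ∷ []
core-table 2 1 2 = (0 ∷ 1 ∷ 2 ∷ 5 ∷ []) ∷ (9 ∷ 10 ∷ []) ∷ []
core-table 2 1 3 = (0 ∷ 1 ∷ 2 ∷ 5 ∷ []) ∷ (9 ∷ 10 ∷ 11 ∷ []) ∷ []
core-table 2 1 4 = (0 ∷ 1 ∷ 2 ∷ 5 ∷ []) ∷ (9 ∷ 10 ∷ 11 ∷ 12 ∷ []) ∷ []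
core-table 2 2 0 = (0 ∷ 1 ∷ 2 ∷ 5 ∷ []) ∷ (6 ∷ []) ∷ []
core-table 2 2 1 = (0 ∷ 1 ∷ 2 ∷ 5 ∷ []) ∷ (9 ∷ 6 ∷ []) ∷ []
core-table 2 2 2 = (0 ∷ 1 ∷ 2 ∷ 5 ∷ []) ∷ (9 ∷ 6 ∷ 10 ∷ []) ∷ []
core-table 2 2 3 = (0 ∷ 1 ∷ 2 ∷ 5 ∷ []) ∷ (9 ∷ 6 ∷ 10 ∷ 11 ∷ []) ∷ []
core-table 2 2 4 = (0 ∷ 1 ∷ 2 ∷ 5 ∷ []) ∷ (9 ∷ 6 ∷ 10 ∷ 11 ∷ []) ∷ (12 ∷ []) ∷ []
core-table 2 3 0 = (0 ∷ 1 ∷ 2 ∷ 5 ∷ []) ∷ (6 ∷ 7 ∷ []) ∷ []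
core-table 2 3 1 = (0 ∷ 1 ∷ 2 ∷ 5 ∷ []) ∷ (9 ∷ 6 ∷ 7 ∷ []) ∷ []
core-table 2 3 2 = (0 ∷ 1 ∷ 2 ∷ 9 ∷ []) ∷ (5 ∷ 10 ∷ 6 ∷ 7 ∷ []) ∷ []
core-table 2 3 3 = (0 ∷ 1 ∷ 2 ∷ 9 ∷ []) ∷ (5 ∷ 10 ∷ 6 ∷ 7 ∷ []) ∷ (11 ∷ []) ∷ []
core-table 2 3 4 = (0 ∷ 1 ∷ 2 ∷ 9 ∷ []) ∷ (5 ∷ 10 ∷ 6 ∷ 7 ∷ []) ∷ (11 ∷ 12 ∷ []) ∷ []
core-table 2 4 0 = (0 ∷ 1 ∷ 2 ∷ 5 ∷ []) ∷ (6 ∷ 7 ∷ 8 ∷ []) ∷ []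
core-table 2 4 1 = (0 ∷ 1 ∷ 2 ∷ 5 ∷ []) ∷ (9 ∷ 6 ∷ 7 ∷ 8 ∷ []) ∷ []
core-table 2 4 2 = (0 ∷ 1 ∷ 2 ∷ 5 ∷ []) ∷ (9 ∷ 6 ∷ 7 ∷ 8 ∷ []) ∷ (10 ∷ []) ∷ []
core-table 2 4 3 = (0 ∷ 1 ∷ 2 ∷ 5 ∷ []) ∷ (9 ∷ 6 ∷ 7 ∷ 8 ∷ []) ∷ (10 ∷ 11 ∷ []) ∷ []
core-table 2 4 4 = (0 ∷ 1 ∷ 2 ∷ 5 ∷ []) ∷ (9 ∷ 6 ∷ 7 ∷ 8 ∷ []) ∷ (10 ∷ 11 ∷ 12 ∷ []) ∷ []
core-table 3 0 0 = (0 ∷ 1 ∷ 2 ∷ 3 ∷ []) ∷ []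
core-table 3 0 1 = (0 ∷ 1 ∷ 2 ∷ 3 ∷ []) ∷ (9 ∷ []) ∷ []
core-table 3 0 2 = (0 ∷ 1 ∷ 2 ∷ 3 ∷ []) ∷ (9 ∷ 10 ∷ []) ∷ []
core-table 3 0 3 = (0 ∷ 1 ∷ 2 ∷ 3 ∷ []) ∷ (9 ∷ 10 ∷ 11 ∷ []) ∷ []
core-table 3 0 4 = (0 ∷ 1 ∷ 2 ∷ 3 ∷ []) ∷ (9 ∷ 10 ∷ 11 ∷ 12 ∷ []) ∷ []
core-table 3 1 0 = (0 ∷ 1 ∷ 2 ∷ 3 ∷ []) ∷ (5 ∷ []) ∷ []
core-table 3 1 1 = (0 ∷ 1 ∷ 2 ∷ 3 ∷ []) ∷ (5 ∷ 9 ∷ []) ∷ []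
core-table 3 1 2 = (0 ∷ 1 ∷ 2 ∷ 3 ∷ []) ∷ (5 ∷ 9 ∷ 10 ∷ []) ∷ []
core-table 3 1 3 = (0 ∷ 1 ∷ 2 ∷ 3 ∷ []) ∷ (5 ∷ 9 ∷ 10 ∷ 11 ∷ []) ∷ []
core-table 3 1 4 = (0 ∷ 1 ∷ 2 ∷ 3 ∷ []) ∷ (5 ∷ 9 ∷ 10 ∷ 11 ∷ []) ∷ (12 ∷ []) ∷ []
core-table 3 2 0 = (0 ∷ 1 ∷ 2 ∷ 3 ∷ []) ∷ (5 ∷ 6 ∷ []) ∷ []
core-table 3 2 1 = (0 ∷ 1 ∷ 2 ∷ 3 ∷ []) ∷ (5 ∷ 9 ∷ 6 ∷ []) ∷ []
core-table 3 2 2 = (0 ∷ 5 ∷ 6 ∷ 9 ∷ []) ∷ (1 ∷ 10 ∷ 2 ∷ 3 ∷ []) ∷ []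
core-table 3 2 3 = (0 ∷ 5 ∷ 6 ∷ 9 ∷ []) ∷ (1 ∷ 10 ∷ 2 ∷ 3 ∷ []) ∷ (11 ∷ []) ∷ []
core-table 3 2 4 = (0 ∷ 5 ∷ 6 ∷ 9 ∷ []) ∷ (1 ∷ 10 ∷ 2 ∷ 3 ∷ []) ∷ (11 ∷ 12 ∷ []) ∷ []
core-table 3 3 0 = (0 ∷ 1 ∷ 2 ∷ 3 ∷ []) ∷ (5 ∷ 6 ∷ 7 ∷ []) ∷ []
core-table 3 3 1 = (0 ∷ 1 ∷ 2 ∷ 3 ∷ []) ∷ (5 ∷ 9 ∷ 6 ∷ 7 ∷ []) ∷ []
core-table 3 3 2 = (0 ∷ 1 ∷ 2 ∷ 3 ∷ []) ∷ (5 ∷ 9 ∷ 6 ∷ 7 ∷ []) ∷ (10 ∷ []) ∷ []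
core-table 3 3 3 = (0 ∷ 1 ∷ 2 ∷ 3 ∷ []) ∷ (5 ∷ 9 ∷ 6 ∷ 7 ∷ []) ∷ (10 ∷ 11 ∷ []) ∷ []
core-table 3 3 4 = (0 ∷ 1 ∷ 2 ∷ 3 ∷ []) ∷ (5 ∷ 9 ∷ 6 ∷ 7 ∷ []) ∷ (10 ∷ 11 ∷ 12 ∷ []) ∷ []
core-table 3 4 0 = (0 ∷ 1 ∷ 2 ∷ 3 ∷ []) ∷ (5 ∷ 6 ∷ 7 ∷ 8 ∷ []) ∷ []
core-table 3 4 1 = (0 ∷ 1 ∷ 2 ∷ 3 ∷ []) ∷ (5 ∷ 6 ∷ 7 ∷ 8 ∷ []) ∷ (9 ∷ []) ∷ []
core-table 3 4 2 = (0 ∷ 1 ∷ 2 ∷ 3 ∷ []) ∷ (5 ∷ 6 ∷ 7 ∷ 8 ∷ []) ∷ (9 ∷ 10 ∷ []) ∷ []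
core-table 3 4 3 = (0 ∷ 1 ∷ 2 ∷ 3 ∷ []) ∷ (5 ∷ 6 ∷ 7 ∷ 8 ∷ []) ∷ (9 ∷ 10 ∷ 11 ∷ []) ∷ []
core-table 3 4 4 = (0 ∷ 1 ∷ 2 ∷ 3 ∷ []) ∷ (5 ∷ 6 ∷ 7 ∷ 8 ∷ []) ∷ (9 ∷ 10 ∷ 11 ∷ 12 ∷ []) ∷ []
core-table 4 0 0 = (0 ∷ 1 ∷ 2 ∷ 3 ∷ []) ∷ (4 ∷ []) ∷ []
core-table 4 0 1 = (0 ∷ 1 ∷ 2 ∷ 3 ∷ []) ∷ (4 ∷ 9 ∷ []) ∷ []
core-table 4 0 2 = (0 ∷ 1 ∷ 2 ∷ 3 ∷ []) ∷ (4 ∷ 9 ∷ 10 ∷ []) ∷ []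
core-table 4 0 3 = (0 ∷ 1 ∷ 2 ∷ 3 ∷ []) ∷ (4 ∷ 9 ∷ 10 ∷ 11 ∷ []) ∷ []
core-table 4 0 4 = (0 ∷ 1 ∷ 2 ∷ 3 ∷ []) ∷ (4 ∷ 9 ∷ 10 ∷ 11 ∷ []) ∷ (12 ∷ []) ∷ []
core-table 4 1 0 = (0 ∷ 1 ∷ 2 ∷ 3 ∷ []) ∷ (4 ∷ 5 ∷ []) ∷ []
core-table 4 1 1 = (0 ∷ 1 ∷ 2 ∷ 5 ∷ []) ∷ (9 ∷ 3 ∷ 4 ∷ []) ∷ []
core-table 4 1 2 = (0 ∷ 1 ∷ 5 ∷ 9 ∷ []) ∷ (2 ∷ 10 ∷ 3 ∷ 4 ∷ []) ∷ []
core-table 4 1 3 = (0 ∷ 1 ∷ 5 ∷ 9 ∷ []) ∷ (2 ∷ 10 ∷ 3 ∷ 4 ∷ []) ∷ (11 ∷ []) ∷ []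
core-table 4 1 4 = (0 ∷ 1 ∷ 5 ∷ 9 ∷ []) ∷ (2 ∷ 10 ∷ 3 ∷ 4 ∷ []) ∷ (11 ∷ 12 ∷ []) ∷ []
core-table 4 2 0 = (0 ∷ 1 ∷ 2 ∷ 3 ∷ []) ∷ (4 ∷ 5 ∷ 6 ∷ []) ∷ []
core-table 4 2 1 = (0 ∷ 1 ∷ 5 ∷ 6 ∷ []) ∷ (9 ∷ 2 ∷ 3 ∷ 4 ∷ []) ∷ []
core-table 4 2 2 = (0 ∷ 1 ∷ 5 ∷ 6 ∷ []) ∷ (9 ∷ 2 ∷ 3 ∷ 4 ∷ []) ∷ (10 ∷ []) ∷ []
core-table 4 2 3 = (0 ∷ 1 ∷ 5 ∷ 6 ∷ []) ∷ (9 ∷ 2 ∷ 3 ∷ 4 ∷ []) ∷ (10 ∷ 11 ∷ []) ∷ []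
core-table 4 2 4 = (0 ∷ 1 ∷ 5 ∷ 6 ∷ []) ∷ (9 ∷ 2 ∷ 3 ∷ 4 ∷ []) ∷ (10 ∷ 11 ∷ 12 ∷ []) ∷ []
core-table 4 3 0 = (0 ∷ 1 ∷ 2 ∷ 3 ∷ []) ∷ (4 ∷ 5 ∷ 6 ∷ 7 ∷ []) ∷ []
core-table 4 3 1 = (0 ∷ 1 ∷ 2 ∷ 3 ∷ []) ∷ (4 ∷ 5 ∷ 6 ∷ 7 ∷ []) ∷ (9 ∷ []) ∷ []
core-table 4 3 2 = (0 ∷ 1 ∷ 2 ∷ 3 ∷ []) ∷ (4 ∷ 5 ∷ 6 ∷ 7 ∷ []) ∷ (9 ∷ 10 ∷ []) ∷ []
core-table 4 3 3 = (0 ∷ 1 ∷ 2 ∷ 3 ∷ []) ∷ (4 ∷ 5 ∷ 6 ∷ 7 ∷ []) ∷ (9 ∷ 10 ∷ 11 ∷ []) ∷ []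
core-table 4 3 4 = (0 ∷ 1 ∷ 2 ∷ 3 ∷ []) ∷ (4 ∷ 5 ∷ 6 ∷ 7 ∷ []) ∷ (9 ∷ 10 ∷ 11 ∷ 12 ∷ []) ∷ []
core-table 4 4 0 = (0 ∷ 1 ∷ 2 ∷ 3 ∷ []) ∷ (4 ∷ 5 ∷ 6 ∷ 7 ∷ []) ∷ (8 ∷ []) ∷ []
core-table 4 4 1 = (0 ∷ 1 ∷ 2 ∷ 3 ∷ []) ∷ (4 ∷ 5 ∷ 6 ∷ 7 ∷ []) ∷ (9 ∷ 8 ∷ []) ∷ []
core-table 4 4 2 = (0 ∷ 1 ∷ 2 ∷ 3 ∷ []) ∷ (4 ∷ 5 ∷ 6 ∷ 7 ∷ []) ∷ (9 ∷ 8 ∷ 10 ∷ []) ∷ []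
core-table 4 4 3 = (0 ∷ 1 ∷ 2 ∷ 3 ∷ []) ∷ (4 ∷ 5 ∷ 6 ∷ 7 ∷ []) ∷ (9 ∷ 8 ∷ 10 ∷ 11 ∷ []) ∷ []
core-table 4 4 4 = (0 ∷ 1 ∷ 2 ∷ 3 ∷ []) ∷ (4 ∷ 5 ∷ 6 ∷ 7 ∷ []) ∷ (9 ∷ 8 ∷ 10 ∷ 11 ∷ []) ∷ (12 ∷ []) ∷ []
core-table _ _ _ = []

core-table-valid : ∀ a b c → a ≤ 4 → b ≤ 4 → c ≤ 4 → ValidScheme (core-table a b c) a b c
core-table-valid a b c a≤4 b≤4 c≤4 =
  All.lookup (All.lookup (All.lookup checked (∈-upTo⁺ (s≤s a≤4))) (∈-upTo⁺ (s≤s b≤4))) (∈-upTo⁺ (s≤s c≤4))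
  where
  checked : All (λ a → All (λ b → All (λ c → ValidScheme (core-table a b c) a b c) (upTo 5)) (upTo 5)) (upTo 5)
  checked = toWitness {a? = All.all? (λ a → All.all? (λ b → All.all? (λ c →
                              validScheme? (core-table a b c) a b c) (upTo 5)) (upTo 5)) (upTo 5)} tt

-- A leg of length x ≥ 1 is cut into a core of length coreLength x ∈ {1,…,4} next to
-- the root, followed by blocks x of 4 consecutive vertices each.
coreLength : ℕ → ℕ
coreLength zero    = 0
coreLength (suc x) = suc (x % 4)

blocks : ℕ → ℕ
blocks zero    = 0
blocks (suc x) = x / 4

coreLength≤4 : ∀ x → coreLength x ≤ 4
coreLength≤4 zero    = z≤n
coreLength≤4 (suc x) = m%n<n x 4

leg-split : ∀ x → x ≡ coreLength x + blocks x * 4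
leg-split zero    = refl
leg-split (suc x) = cong suc (m≡m%n+[m/n]*n x 4)

-- B(l)² with three legs.
--
-- The cores of the legs together with the root form a spider with legs of length at
-- most 4, coloured first according to the scheme of the table.  Then come the blocks,
-- leg after leg, each block a chunk coloured outwards.  A vertex in a block has at most
-- three earlier vertices close to it or in its block: the (at most three) vertices
-- before it on its leg within distance three, or the root and one vertex before it.
module ThreeLegs (l : Fin 3 → ℕ) where

  open Spider 3 l

  r : Fin 3 → ℕ
  r i = coreLength (l i)

  q : Fin 3 → ℕ
  q i = blocks (l i)

  r≤4 : ∀ i → r i ≤ 4
  r≤4 i = coreLength≤4 (l i)

  scheme : List (List ℕ)
  scheme = core-table (r zero) (r (suc zero)) (r (suc (suc zero)))

  codes : List ℕ
  codes = coreCodes (r zero) (r (suc zero)) (r (suc (suc zero)))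

  C : ℕ
  C = length scheme

  valid : ValidScheme scheme (r zero) (r (suc zero)) (r (suc (suc zero)))
  valid = core-table-valid _ _ _ (r≤4 zero) (r≤4 (suc zero)) (r≤4 (suc (suc zero)))

  placed : ∀ {x} → x ∈ codes → chunkOf scheme x < C × placeOf scheme x < 4
  placed = All.lookup (proj₁ valid)

  codeRank-injective : ∀ {x y} → x ∈ codes → y ∈ codes → codeRank scheme x ≡ codeRank scheme y → x ≡ y
  codeRank-injective x∈ y∈ = All.lookup (All.lookup (proj₁ (proj₂ valid)) x∈) y∈

  few-chunks : C ≤ (1 + r zero + r (suc zero) + r (suc (suc zero)) + 3) / 4
  few-chunks = proj₁ (proj₂ (proj₂ valid))

  small-back : ∀ {x} → x ∈ codes → length (filter (codeBack? scheme x) codes) ≤ 3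
  small-back = All.lookup (proj₂ (proj₂ (proj₂ valid)))

  -- the scheme ranks stay below 4 · C, where the block ranks start
  codeRank<C*4 : ∀ {x} → x ∈ codes → codeRank scheme x < C * 4
  codeRank<C*4 {x} x∈ =
    subst (codeRank scheme x <_) (+-identityʳ (C * 4)) (lex-step 4 _ C _ 0 (proj₁ (placed x∈)) (proj₂ (placed x∈)))

  Core : V → Set
  Core root      = ⊤
  Core (leg i j) = toℕ j < r i

  code : V → ℕ
  code root      = 0
  code (leg i j) = suc (toℕ i * 4 + toℕ j)

  code∈codes : ∀ {v} → Core v → code v ∈ codes
  code∈codes {root}                    _   = here refl
  code∈codes {leg zero j}              j<r = there (∈-++⁺ˡ (∈-applyUpTo⁺ (1 +_) j<r))
  code∈codes {leg (suc zero) j}        j<r =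
    there (∈-++⁺ʳ (applyUpTo (1 +_) (r zero)) (∈-++⁺ˡ (∈-applyUpTo⁺ (5 +_) j<r)))
  code∈codes {leg (suc (suc zero)) j}  j<r =
    there (∈-++⁺ʳ (applyUpTo (1 +_) (r zero)) (∈-++⁺ʳ (applyUpTo (5 +_) (r (suc zero))) (∈-applyUpTo⁺ (9 +_) j<r)))

  code-injective : ∀ {v w} → Core v → Core w → code v ≡ code w → v ≡ w
  code-injective {root}    {root}      _   _    _ = refl
  code-injective {leg i j} {leg i' j'} j<r j'<r e
    with lex-≡ 4 (toℕ i) (toℕ i') (toℕ j) (toℕ j') (≤-trans j<r (r≤4 i)) (≤-trans j'<r (r≤4 i')) (suc-injective e)
  ... | i≡ , j≡ with toℕ-injective i≡
  ... | refl = cong (leg i) (toℕ-injective j≡)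

  core? : ∀ v → Dec (Core v)
  core? root      = yes tt
  core? (leg i j) = toℕ j <? r i

  blockIndex : ∀ i → Fin (l i) → ℕ
  blockIndex i j = prefix q i * 4 + (toℕ j ∸ r i)

  outerIndex : V → ℕ
  outerIndex root      = 0
  outerIndex (leg i j) = blockIndex i j

  rank : V → ℕ
  rank v with core? v
  ... | yes _ = codeRank scheme (code v)
  ... | no  _ = C * 4 + outerIndex v

  chunk : V → ℕ
  chunk v with core? v
  ... | yes _ = chunkOf scheme (code v)
  ... | no  _ = C + outerIndex v / 4

  rank-core : ∀ {v} → Core v → rank v ≡ codeRank scheme (code v)
  rank-core {v} c with core? v
  ... | yes _  = refl
  ... | no  ¬c = contradiction c ¬c

  chunk-core : ∀ {v} → Core v → chunk v ≡ chunkOf scheme (code v)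
  chunk-core {v} c with core? v
  ... | yes _  = refl
  ... | no  ¬c = contradiction c ¬c

  rank-outer : ∀ {v} → ¬ Core v → rank v ≡ C * 4 + outerIndex v
  rank-outer {v} ¬c with core? v
  ... | yes c = contradiction c ¬c
  ... | no  _ = refl

  chunk-outer : ∀ {v} → ¬ Core v → chunk v ≡ C + outerIndex v / 4
  chunk-outer {v} ¬c with core? v
  ... | yes c = contradiction c ¬c
  ... | no  _ = refl

  in-leg-blocks : ∀ i (j : Fin (l i)) → r i ≤ toℕ j → prefix q i ≤ blockIndex i j / 4 × blockIndex i j / 4 < prefix q i + q i
  in-leg-blocks i j r≤j =
    subst (_≤ blockIndex i j / 4) (m*n/n≡m (prefix q i) 4) (/-monoˡ-≤ 4 (m≤m+n (prefix q i * 4) (toℕ j ∸ r i))) ,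
    m<n*o⇒m/o<n (begin-strict
      prefix q i * 4 + (toℕ j ∸ r i)  <⟨ +-monoʳ-< (prefix q i * 4) (+-cancelˡ-< (r i) _ _
                                           (subst₂ _<_ (sym (m+[n∸m]≡n r≤j)) (leg-split (l i)) (toℕ<n j))) ⟩
      prefix q i * 4 + q i * 4        ≡⟨ *-distribʳ-+ 4 (prefix q i) (q i) ⟨
      (prefix q i + q i) * 4          ∎)
    where open ≤-Reasoning

  same-block-leg : ∀ i j a b → r i ≤ toℕ j → r a ≤ toℕ b → blockIndex i j / 4 ≡ blockIndex a b / 4 → i ≡ a
  same-block-leg i j a b r≤j r≤b e =
    let i≤ , <i = in-leg-blocks i j r≤j ; a≤ , <a = in-leg-blocks a b r≤b
    in  prefix-disjoint q i a (blockIndex i j / 4) i≤ <i (subst (prefix q a ≤_) (sym e) a≤) (subst (_< prefix q a + q a) (sym e) <a)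

  block-along-leg : ∀ i (j j' : Fin (l i)) → r i ≤ toℕ j → r i ≤ toℕ j' → toℕ j ∸ r i ≡ toℕ j' ∸ r i → j ≡ j'
  block-along-leg i j j' r≤j r≤j' e = toℕ-injective (trans (sym (m+[n∸m]≡n r≤j)) (trans (cong (r i +_) e) (m+[n∸m]≡n r≤j')))

  core-before-outer : ∀ {x} → Core x → ∀ n → codeRank scheme (code x) < C * 4 + n
  core-before-outer c n = <-≤-trans (codeRank<C*4 (code∈codes c)) (m≤m+n (C * 4) n)

  outer-injective : ∀ v w → ¬ Core v → ¬ Core w → outerIndex v ≡ outerIndex w → v ≡ w
  outer-injective root      _         ¬c _   _ = contradiction tt ¬c
  outer-injective (leg i j) root      _  ¬c' _ = contradiction tt ¬c'
  outer-injective (leg i j) (leg a b) ¬c ¬c' e with same-block-leg i j a b (≮⇒≥ ¬c) (≮⇒≥ ¬c') (cong (_/ 4) e)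
  ... | refl = cong (leg i) (block-along-leg i j b (≮⇒≥ ¬c) (≮⇒≥ ¬c') (+-cancelˡ-≡ (prefix q i * 4) _ _ e))

  rank-injective : ∀ {v w} → rank v ≡ rank w → v ≡ w
  rank-injective {v} {w} e = by-kind (core? v) (core? w)
    where
    by-kind : Dec (Core v) → Dec (Core w) → v ≡ w
    by-kind (yes c) (yes c') = code-injective c c' (codeRank-injective (code∈codes c) (code∈codes c')
                                 (trans (sym (rank-core c)) (trans e (rank-core c'))))
    by-kind (yes c) (no ¬c') = contradiction (trans (sym (rank-core c)) (trans e (rank-outer ¬c'))) (<⇒≢ (core-before-outer c _))
    by-kind (no ¬c) (yes c') = contradiction (trans (sym (rank-core c')) (trans (sym e) (rank-outer ¬c))) (<⇒≢ (core-before-outer c' _))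
    by-kind (no ¬c) (no ¬c') = outer-injective v w ¬c ¬c' (+-cancelˡ-≡ (C * 4) _ _ (trans (sym (rank-outer ¬c)) (trans e (rank-outer ¬c'))))

  B : ℕ
  B = C + total q

  chunk<B : ∀ v → chunk v < B
  chunk<B v = by-kind (core? v)
    where
    by-kind : Dec (Core v) → chunk v < B
    by-kind (yes c) = subst (_< B) (sym (chunk-core c)) (<-≤-trans (proj₁ (placed (code∈codes c))) (m≤m+n C (total q)))
    by-kind (no ¬c) = subst (_< B) (sym (chunk-outer ¬c)) (+-monoʳ-< C (outer-block<total v ¬c))
      where
      outer-block<total : ∀ v → ¬ Core v → outerIndex v / 4 < total q
      outer-block<total root      ¬c = contradiction tt ¬c
      outer-block<total (leg i j) ¬c = <-≤-trans (proj₂ (in-leg-blocks i j (≮⇒≥ ¬c))) (prefix-end≤total q i)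

  -- the core scheme uses at most ⌈ |core| / 4 ⌉ chunks, and the blocks fill their chunks
  B≤ : B ≤ ⌈ length vs / 4 ⌉
  B≤ = begin
    C + total q                            ≤⟨ +-monoˡ-≤ (total q) few-chunks ⟩
    coreSize / 4 + total q                 ≡⟨ cong (coreSize / 4 +_) (m*n/n≡m (total q) 4) ⟨
    coreSize / 4 + total q * 4 / 4         ≡⟨ +-distrib-/-∣ʳ coreSize (n∣m*n (total q)) ⟨
    (coreSize + total q * 4) / 4           ≡⟨ cong (_/ 4) count ⟨
    suc (total l + 3) / 4                  ≡⟨ cong (_/ 4) (+-suc (total l) 3) ⟨
    ⌈ N / 4 ⌉                              ≡⟨ cong (λ n → ⌈ n / 4 ⌉) length-vs ⟨
    ⌈ length vs / 4 ⌉                      ∎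
    where
    open ≤-Reasoning
    coreSize : ℕ
    coreSize = 1 + r zero + r (suc zero) + r (suc (suc zero)) + 3
    rearrange : ∀ a b c x y z → suc (a + x * 4 + (b + y * 4 + (c + z * 4 + 0)) + 3) ≡ 1 + a + b + c + 3 + (x + (y + (z + 0))) * 4
    rearrange = solve-∀
    count : suc (total l + 3) ≡ coreSize + total q * 4
    count = trans (cong (λ n → suc (n + 3)) (cong₂ _+_ (leg-split (l zero))
                    (cong₂ _+_ (leg-split (l (suc zero))) (cong (_+ 0) (leg-split (l (suc (suc zero))))))))
                  (rearrange (r zero) (r (suc zero)) (r (suc (suc zero))) (q zero) (q (suc zero)) (q (suc (suc zero))))

  open GreedyEquitable vs vs-unique vs-complete Close close? rank rank-injective chunk

  rank< : ∀ {v w} → w ∈ back v → rank w < rank v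
  rank< {v} w∈ = proj₁ (back-sound {v} w∈)

  back-of-core : ∀ {v w} → Core v → w ∈ back v → Core w
  back-of-core {v} {w} c w∈ = decidable-stable (core? w) λ ¬c' →
    <-asym (rank< {v} w∈) (subst₂ _<_ (sym (rank-core c)) (sym (rank-outer ¬c')) (core-before-outer c _))

  decode : ∀ i (j : Fin (l i)) → Core (leg i j) → (toℕ i * 4 + toℕ j) / 4 ≡ toℕ i × (toℕ i * 4 + toℕ j) % 4 ≡ toℕ j
  decode i j c = divmod-unique 4 (toℕ i) (toℕ j) (≤-trans c (r≤4 i))

  close-code : ∀ {v w} → Core v → Core w → Close v w → CodeClose (code v) (code w)
  close-code {root}    {leg i j}   _ c  cl = subst (_≤ 1) (sym (proj₂ (decode i j c))) cl
  close-code {leg i j} {root}      c _  cl = subst (_≤ 1) (sym (proj₂ (decode i j c))) cl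
  close-code {leg i j} {leg i' j'} c c' cl
    rewrite proj₁ (decode i j c) | proj₂ (decode i j c) | proj₁ (decode i' j' c') | proj₂ (decode i' j' c') = cl

  -- The back set of a core vertex, read through the codes, is its back set in the scheme.
  core-bound : ∀ {v} → Core v → length (back v) ≤ 3
  core-bound {v} c = ≤-trans
    (injection-length (back v) code (filter (codeBack? scheme (code v)) codes) (back-unique v) in-scheme-back
      (λ p q w≢w' e → w≢w' (code-injective (back-of-core c p) (back-of-core c q) e)))
    (small-back (code∈codes c))
    where
    in-scheme-back : ∀ {w} → w ∈ back v → code w ∈ filter (codeBack? scheme (code v)) codes
    in-scheme-back {w} w∈ = ∈-filter⁺ (codeBack? scheme (code v)) (code∈codes c')
      (subst₂ _<_ (rank-core c') (rank-core c) w<v ,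
       map-⊎ (close-code c c') (λ same → trans (sym (chunk-core c')) (trans same (chunk-core c))) close-or-same)
      where
      c' : Core w
      c' = back-of-core c w∈
      w<v : rank w < rank v
      w<v = proj₁ (back-sound {v} w∈)
      close-or-same : Close v w ⊎ chunk w ≡ chunk v
      close-or-same = proj₂ (back-sound {v} w∈)

  index-from-rank : ∀ i (b j : Fin (l i)) → r i ≤ toℕ j → rank (leg i b) < rank (leg i j) → toℕ b < toℕ j
  index-from-rank i b j r≤j b<j = by-kind (toℕ b <? r i)
    where
    by-kind : Dec (toℕ b < r i) → toℕ b < toℕ j
    by-kind (yes b<r) = <-≤-trans b<r r≤j
    by-kind (no ¬b<r) = subst₂ _<_ (m+[n∸m]≡n (≮⇒≥ ¬b<r)) (m+[n∸m]≡n r≤j) (+-monoʳ-< (r i)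
      (+-cancelˡ-< (prefix q i * 4) _ _ (+-cancelˡ-< (C * 4) _ _ (subst₂ _<_ (rank-outer ¬b<r) (rank-outer (≤⇒≯ r≤j)) b<j))))

  -- An outer vertex v = vertex j of leg i.  Its back set holds only the root (when j = 1)
  -- and vertices b of leg i with b < j ≤ b + 3, which the gap j - b - 1 tells apart.
  module OuterBound (i : Fin 3) (j : Fin (l i)) (r≤j : r i ≤ toℕ j) where

    v : V
    v = leg i j

    not-core : ¬ Core v
    not-core = ≤⇒≯ r≤j

    1≤j : 1 ≤ toℕ j
    1≤j = ≤-trans (core-nonempty (l i) (<-≤-trans (s≤s z≤n) (toℕ<n j))) r≤j
      where
      core-nonempty : ∀ x → 1 ≤ x → 1 ≤ coreLength x
      core-nonempty (suc x) _ = s≤s z≤n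

    core-chunk< : ∀ {w} → Core w → chunk w < chunk v
    core-chunk< c = subst₂ _<_ (sym (chunk-core c)) (sym (chunk-outer not-core))
      (<-≤-trans (proj₁ (placed (code∈codes c))) (m≤m+n C _))

    root-back : root ∈ back v → toℕ j ≡ 1
    root-back r∈ with proj₂ (back-sound {v} r∈)
    ... | inj₁ j≤1 = ≤-antisym j≤1 1≤j
    ... | inj₂ same = contradiction same (<⇒≢ (core-chunk< tt))

    leg-back : ∀ a b → leg a b ∈ back v → toℕ a ≡ toℕ i × toℕ b < toℕ j × toℕ j ≤ toℕ b + 3
    leg-back a b w∈ = [ via-close , via-chunk ] (proj₂ (back-sound {v} w∈))
      where
      b<j : toℕ a ≡ toℕ i → toℕ b < toℕ j
      b<j a≡i with toℕ-injective a≡i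
      ... | refl = index-from-rank i b j r≤j (rank< {v} w∈)

      via-close : Close v (leg a b) → toℕ a ≡ toℕ i × toℕ b < toℕ j × toℕ j ≤ toℕ b + 3
      via-close (inj₂ (j≡0 , _))          = contradiction (subst (1 ≤_) j≡0 1≤j) (λ ())
      via-close (inj₁ (i≡a , j≤b+2 , _)) = sym i≡a , b<j (sym i≡a) , ≤-trans j≤b+2 (+-monoʳ-≤ (toℕ b) (n≤1+n 2))

      via-chunk : chunk (leg a b) ≡ chunk v → toℕ a ≡ toℕ i × toℕ b < toℕ j × toℕ j ≤ toℕ b + 3
      via-chunk same = by-kind (toℕ b <? r a)
        where
        by-kind : Dec (toℕ b < r a) → toℕ a ≡ toℕ i × toℕ b < toℕ j × toℕ j ≤ toℕ b + 3
        by-kind (yes b<r) = contradiction same (<⇒≢ (core-chunk< {leg a b} b<r))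
        by-kind (no ¬b<r) with same-block-leg a b i j (≮⇒≥ ¬b<r) r≤j same-block
          where
          same-block : blockIndex a b / 4 ≡ blockIndex i j / 4
          same-block = +-cancelˡ-≡ C _ _ (trans (sym (chunk-outer ¬b<r)) (trans same (chunk-outer not-core)))
        ... | refl = refl , b<j refl , within-block
          where
          within-block : toℕ j ≤ toℕ b + 3
          within-block = begin
            toℕ j                    ≡⟨ m+[n∸m]≡n r≤j ⟨
            r i + (toℕ j ∸ r i)      ≤⟨ +-monoʳ-≤ (r i) (+-cancelˡ-≤ (prefix q i * 4) _ _
                                         (subst (blockIndex i j ≤_) (+-assoc (prefix q i * 4) _ 3)
                                           (same-quotient (blockIndex i b) (blockIndex i j) 3
                                             (+-cancelˡ-≡ C _ _ (trans (sym (chunk-outer ¬b<r)) (trans same (chunk-outer not-core))))))) ⟩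
            r i + (toℕ b ∸ r i + 3)  ≡⟨ +-assoc (r i) _ 3 ⟨
            r i + (toℕ b ∸ r i) + 3  ≡⟨ cong (_+ 3) (m+[n∸m]≡n (≮⇒≥ ¬b<r)) ⟩
            toℕ b + 3                ∎
            where open ≤-Reasoning

    gap : V → ℕ
    gap root       = 1
    gap (leg _ b)  = toℕ j ∸ suc (toℕ b)

    gap<3 : ∀ {w} → w ∈ back v → gap w < 3
    gap<3 {root}    _  = s≤s (s≤s z≤n)
    gap<3 {leg a b} w∈ =
      s≤s (m≤n+o⇒m∸n≤o (toℕ j) (suc (toℕ b)) (subst (toℕ j ≤_) (+-suc (toℕ b) 2) (proj₂ (proj₂ (leg-back a b w∈)))))

    root-gap : root ∈ back v → ∀ b → toℕ j ∸ suc b ≢ 1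
    root-gap r∈ b e = contradiction (trans (sym (trans (cong (_∸ suc b) (root-back r∈)) (0∸n≡0 b))) e) (λ ())

    gap-injective : ∀ {w w'} → w ∈ back v → w' ∈ back v → w ≢ w' → gap w ≢ gap w'
    gap-injective {root}    {root}      _ _ w≢w' _ = w≢w' refl
    gap-injective {root}    {leg a b}   p _ _    e = root-gap p (toℕ b) (sym e)
    gap-injective {leg a b} {root}      _ q _    e = root-gap q (toℕ b) e
    gap-injective {leg a b} {leg a' b'} p q w≢w' e
      with toℕ-injective (trans (proj₁ (leg-back a b p)) (sym (proj₁ (leg-back a' b' q))))
    ... | refl = w≢w' (cong (leg a) (toℕ-injective (suc-injective (begin
      suc (toℕ b)                         ≡⟨ m∸[m∸n]≡n (proj₁ (proj₂ (leg-back a b p))) ⟨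
      toℕ j ∸ (toℕ j ∸ suc (toℕ b))       ≡⟨ cong (toℕ j ∸_) e ⟩
      toℕ j ∸ (toℕ j ∸ suc (toℕ b'))      ≡⟨ m∸[m∸n]≡n (proj₁ (proj₂ (leg-back a b' q))) ⟩
      suc (toℕ b')                        ∎))))
      where open ≡-Reasoning

    bound : length (back v) ≤ 3
    bound = injection-bound (back v) gap 3 (back-unique v) gap<3 gap-injective

  back-bound : ∀ v → length (back v) ≤ 3
  back-bound v = by-kind v (core? v)
    where
    by-kind : ∀ v → Dec (Core v) → length (back v) ≤ 3
    by-kind v         (yes c)  = core-bound c
    by-kind root      (no ¬c)  = contradiction tt ¬c
    by-kind (leg i j) (no ¬c)  = OuterBound.bound i j (≮⇒≥ ¬c)

  square-equitably-choosable : EquitablyChoosable vs BSqAdj 4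
  square-equitably-choosable = equitably-choosable 3 B back-bound chunk<B B≤ BSqAdj proj₁ square-sym square⇒close

lemma2p8 : (m : ℕ) → 3 Data.Nat.≤ m → (l : Fin m → ℕ) →
    ((i j : Fin m) → i Data.Fin.≤ j → l i Data.Nat.≤ l j) →
    EquitablyChoosable (bVertices m l) (BSqAdj {m} {l}) (suc m)
lemma2p8 (suc zero)                (s≤s ())
lemma2p8 (suc (suc zero))          (s≤s (s≤s ()))
lemma2p8 (suc (suc (suc zero)))    _ l _         = ThreeLegs.square-equitably-choosable l
lemma2p8 (suc (suc (suc (suc n)))) _ l ascending =
  ManyLegs.square-equitably-choosable (4 + n) (s≤s (s≤s (s≤s (s≤s z≤n)))) l ascending
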